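{- Let $\mathbf a=(a_1,\dots,a_n)$ be a circular area sequence. Then the chromatic quasisymmetric function $\mathrm X_{\mathbf a}(\mathbf x;q)$ is a symmetric function in $\mathbf x=(x_1,x_2,\dots)$ (with coefficients in $\mathbb Z[q]$).
   Context: A circular area sequence is an integer sequence $\mathbf a=(a_1,\dots,a_n)$ with $0\le a_i\le n-1$ and $a_i-1\le a_{i+1}$ for all $i$, indices modulo $n$. The circular unit arc digraph $\Gamma_{\mathbf a}$ is the directed graph on vertex set $[n]$ with directed edges $i\to i+1, i\to i+2,\dots,i\to i+a_i$ for each $i$, vertex labels taken modulo $n$. A coloring is a map $F:[n]\to\mathbb Z_{>0}$; it is proper (non-attacking) if $F(i)\ne F(j)$ whenever $i\to j$ is an edge; $\mathbf x^F=\prod_{v\in[n]}x_{F(v)}$; $\mathrm{asc}_{\mathbf a}(F)$ is the number of directed edges $i\to j$ of $\Gamma_{\mathbf a}$ with $F(i)<F(j)$. Then $\mathrm X_{\mathbf a}(\mathbf x;q)=\sum_{F\text{ proper}}\mathbf x^F q^{\mathrm{asc}_{\mathbf a}(F)}$. -}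

module Defs where

open import Data.Nat using (ℕ; zero; suc; _+_; _≤_; _<?_; _≟_)
open import Data.Nat.DivMod using (_%_; m%n<n)
open import Data.Fin using (Fin; toℕ; fromℕ<)
open import Data.Fin.Base using ()
open import Data.List using (List; length; filter; map; applyUpTo; allFin)
open import Data.Nat.ListAction using (sum)
open import Data.List.Relation.Unary.Unique.Propositional using (Unique)
open import Data.List.Membership.Propositional using (_∈_)
open import Data.Vec using (Vec; lookup)
open import Data.Product using (_×_)
open import Relation.Binary.PropositionalEquality using (_≡_; _≢_)
open import Function.Bundles using (_⇔_)

-- Vertices of Γ_a are Fin n with n = suc m (vertex i : Fin n stands for i+1 ∈ [n]).
-- Colors: a color c : ℕ stands for the positive integer c+1 (order preserved).

shift : ∀ {m} → Fin (suc m) → ℕ → Fin (suc m)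
shift {m} i d = fromℕ< (m%n<n (toℕ i + d) (suc m))

CircularAreaSeq : ∀ {m} → (Fin (suc m) → ℕ) → Set
CircularAreaSeq {m} a = (∀ i → a i ≤ m) × (∀ i → a i ≤ a (shift i 1) + 1)

-- Edges of Γ_a: i → shift i d for 1 ≤ d ≤ a i (these targets are distinct since a i ≤ n-1)
Coloring : ℕ → Set
Coloring m = Vec ℕ (suc m)

Proper : ∀ {m} → (Fin (suc m) → ℕ) → Coloring m → Set
Proper a F = ∀ i d → 1 ≤ d → d ≤ a i → lookup F i ≢ lookup F (shift i d)

asc : ∀ {m} → (Fin (suc m) → ℕ) → Coloring m → ℕ
asc {m} a F =
  sum (map (λ i → length (filter (λ d → lookup F i <? lookup F (shift i d))
                                 (applyUpTo suc (a i))))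
           (allFin (suc m)))

-- x^F = x^α, i.e. color c is used exactly α c times
HasContent : ∀ {m} → Coloring m → (ℕ → ℕ) → Set
HasContent {m} F α = ∀ c → length (filter (λ i → lookup F i ≟ c) (allFin (suc m))) ≡ α c

-- L is a duplicate-free list of exactly the proper colorings F with x^F = x^α and asc F = k;
-- its length is then the coefficient of x^α q^k in X_a(x;q).
EnumeratesCoeff : ∀ {m} → (Fin (suc m) → ℕ) → (ℕ → ℕ) → ℕ → List (Coloring m) → Set
EnumeratesCoeff a α k L =
  Unique L × (∀ F → (F ∈ L) ⇔ (Proper a F × HasContent F α × asc a F ≡ k))

module Submission where

-- A colouring uses finitely many colours, so it suffices to treat the transposition of two adjacent
-- colours c and c + 1, by an involution in the style of Shareshian and Wachs. Since a_{i+1} ≥ a_i - 1,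
-- a vertex lying under an edge is adjacent to both ends of that edge; hence, going around the circle,
-- the vertices coloured c or c + 1 split into runs in which each vertex has an edge to the next, and
-- colours alternate along a run. Swapping c and c + 1 on every run of odd length exchanges the numbers
-- of vertices of the two colours and keeps the colouring proper. It also keeps the number of ascents:
-- an edge inside a run ascends iff its source has colour c, an odd run has as many such sources of
-- either colour, and comparisons with the other colours are unaffected. If no vertex ends a run, the
-- vertices coloured c or c + 1 form a single alternating cycle, which is even and is left alone.

open import Algebra.Properties.CommutativeSemigroup using (interchange; x∙yz≈y∙xz)
open import Data.Bool using (Bool; true; false; not; _∧_; _∨_; _xor_; if_then_else_; T)
open import Data.Bool.Properties using (not-involutive; xor-comm; xor-identityʳ; ∧-identityʳ; ∧-zeroʳ; ∨-zeroʳ)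
open import Data.Empty using (⊥; ⊥-elim)
open import Data.Fin as Fin using (Fin; toℕ; fromℕ<)
open import Data.Fin.Properties using (fromℕ<-cong; fromℕ<-toℕ; toℕ-fromℕ<; toℕ<n)
open import Data.List as List using (List; []; _∷_; length; map; _++_; filter; applyUpTo; upTo; allFin; [_])
open import Data.List.Membership.Propositional using (_∈_)
open import Data.List.Membership.Propositional.Properties
  using (∈-∃++; ∈-++⁻; ∈-++⁺ˡ; ∈-++⁺ʳ; ∈-map⁻; ∈-filter⁻; ∈-filter⁺; ∈-upTo⁺)
open import Data.List.Properties using (length-++; length-map; ++-assoc; filter-none)
open import Data.List.Relation.Binary.Permutation.Propositional using (_↭_; refl; prep; swap; trans; ↭-sym)
open import Data.List.Relation.Binary.Permutation.Propositional.Properties using () renaming (shift to ↭-shift)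
open import Data.List.Relation.Unary.All as All using (All; []; _∷_; universal)
open import Data.List.Relation.Unary.AllPairs using ([]; _∷_)
open import Data.List.Relation.Unary.Any using (here; there)
open import Data.List.Relation.Unary.Unique.Propositional using (Unique)
open import Data.List.Relation.Unary.Unique.Propositional.Properties using (filter⁺; upTo⁺)
open import Data.Maybe as Maybe using (Maybe; just; nothing)
open import Data.Nat using (ℕ; zero; suc; _+_; _∸_; _≤_; _<_; z≤n; s≤s; _≟_; _≤?_; _<?_; _≡ᵇ_; NonZero)
open import Data.Nat.DivMod using (_%_; m%n<n; %-distribˡ-+; m%n%n≡m%n; [m+n]%n≡m%n; m<n⇒m%n≡m)
open import Data.Nat.ListAction using (sum)
open import Data.Nat.Properties
open import Data.Nat.Solver using (module +-*-Solver)
open import Data.Product using (Σ; _×_; _,_; proj₁; proj₂)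
open import Data.Sum using (_⊎_; inj₁; inj₂)
open import Data.Vec as Vec using (Vec; lookup; tabulate) renaming (_∷_ to _∷ᵛ_)
open import Data.Vec.Properties using (lookup∘tabulate; tabulate∘lookup; tabulate-cong)
open import Function using (_∘_; _∘′_; id)
open import Function.Bundles using (_↔_; _⇔_; Inverse; mk⇔; Equivalence)
open import Relation.Binary using (tri<; tri≈; tri>)
open import Relation.Binary.PropositionalEquality as ≡
  using (_≡_; _≢_; _≗_; refl; sym; cong; cong₂; subst; module ≡-Reasoning)
open import Relation.Nullary using (Dec; yes; no; does; ¬_)
open import Relation.Nullary.Decidable using (dec-true; dec-false; does-⇔)

open import Defs

⟦_⟧ : Bool → ℕ
⟦ true ⟧ = 1
⟦ false ⟧ = 0

true≢false : true ≢ false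
true≢false ()

∑< : ℕ → (ℕ → ℕ) → ℕ
∑< zero f = 0
∑< (suc n) f = f 0 + ∑< n (f ∘ suc)

syntax ∑< n (λ i → e) = ∑[ i < n ] e

∑-cong : ∀ n {f g : ℕ → ℕ} → (∀ i → i < n → f i ≡ g i) → ∑< n f ≡ ∑< n g
∑-cong zero _ = refl
∑-cong (suc n) e = cong₂ _+_ (e 0 (s≤s z≤n)) (∑-cong n (λ i p → e (suc i) (s≤s p)))

∑-distrib-+ : ∀ n (f g : ℕ → ℕ) → ∑[ i < n ] (f i + g i) ≡ ∑< n f + ∑< n g
∑-distrib-+ zero f g = refl
∑-distrib-+ (suc n) f g =
  ≡.trans (cong (f 0 + g 0 +_) (∑-distrib-+ n (f ∘ suc) (g ∘ suc)))
          (interchange +-commutativeSemigroup (f 0) (g 0) (∑< n (f ∘ suc)) (∑< n (g ∘ suc)))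

∑-zero : ∀ n → ∑[ i < n ] 0 ≡ 0
∑-zero zero = refl
∑-zero (suc n) = ∑-zero n

∑-one : ∀ n (f : ℕ → ℕ) → (∀ i → f i ≡ 1) → ∑< n f ≡ n
∑-one zero f e = refl
∑-one (suc n) f e = cong₂ _+_ (e 0) (∑-one n (f ∘ suc) (e ∘ suc))

term≤∑ : ∀ n (f : ℕ → ℕ) {i} → i < n → f i ≤ ∑< n f
term≤∑ (suc n) f {zero} _ = m≤m+n (f 0) _
term≤∑ (suc n) f {suc i} (s≤s i<n) = ≤-trans (term≤∑ n (f ∘ suc) i<n) (m≤n+m _ (f 0))

∑-telescope : ∀ n (f g u v : ℕ → ℕ) →
              (∀ j → j < n → f j + u (suc j) + v j ≡ g j + u j + v (suc j)) →
              ∑< n f + u n + v 0 ≡ ∑< n g + u 0 + v n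
∑-telescope zero f g u v e = refl
∑-telescope (suc n) f g u v e = +-cancelʳ-≡ (u 1 + v 1) _ _ (begin
  f 0 + ∑< n (f ∘ suc) + u (suc n) + v 0 + (u 1 + v 1)
    ≡⟨ regroup (f 0) (∑< n (f ∘ suc)) (u (suc n)) (v 0) (u 1) (v 1) ⟩
  (f 0 + u 1 + v 0) + (∑< n (f ∘ suc) + u (suc n) + v 1)
    ≡⟨ cong₂ _+_ (e 0 (s≤s z≤n))
         (∑-telescope n (f ∘ suc) (g ∘ suc) (u ∘ suc) (v ∘ suc) (λ j p → e (suc j) (s≤s p))) ⟩
  (g 0 + u 0 + v 1) + (∑< n (g ∘ suc) + u 1 + v (suc n))
    ≡⟨ regroup′ (g 0) (∑< n (g ∘ suc)) (u 0) (v (suc n)) (u 1) (v 1) ⟩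
  g 0 + ∑< n (g ∘ suc) + u 0 + v (suc n) + (u 1 + v 1) ∎)
  where
  open ≡-Reasoning
  open +-*-Solver
  regroup : ∀ a x u v u₁ v₁ → a + x + u + v + (u₁ + v₁) ≡ (a + u₁ + v) + (x + u + v₁)
  regroup = solve 6 (λ a x u v u₁ v₁ → a :+ x :+ u :+ v :+ (u₁ :+ v₁) := (a :+ u₁ :+ v) :+ (x :+ u :+ v₁)) refl
  regroup′ : ∀ b y u v u₁ v₁ → (b + u + v₁) + (y + u₁ + v) ≡ b + y + u + v + (u₁ + v₁)
  regroup′ = solve 6 (λ b y u v u₁ v₁ → (b :+ u :+ v₁) :+ (y :+ u₁ :+ v) := b :+ y :+ u :+ v :+ (u₁ :+ v₁)) refl

∑-rotate : ∀ n (g : ℕ → ℕ) → (∀ y → g (y + n) ≡ g y) → ∀ r → ∑[ j < n ] g (r + j) ≡ ∑< n g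
∑-rotate n g periodic zero = refl
∑-rotate n g periodic (suc r) = begin
  ∑[ j < n ] g (suc r + j)     ≡⟨ ∑-cong n (λ j _ → cong g (sym (+-suc r j))) ⟩
  ∑[ j < n ] g (r + suc j)     ≡⟨ +-cancelʳ-≡ (g (r + 0)) _ _ step ⟩
  ∑[ j < n ] g (r + j)         ≡⟨ ∑-rotate n g periodic r ⟩
  ∑< n g                       ∎
  where
  open ≡-Reasoning
  shift-last : ∀ n (f : ℕ → ℕ) → ∑< n (f ∘ suc) + f 0 ≡ ∑< n f + f n
  shift-last zero f = refl
  shift-last (suc n) f = begin
    f 1 + ∑< n (f ∘ suc ∘ suc) + f 0   ≡⟨ rearrange (f 1) _ (f 0) ⟩
    f 0 + (∑< n (f ∘ suc ∘ suc) + f 1) ≡⟨ cong (f 0 +_) (shift-last n (f ∘ suc)) ⟩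
    f 0 + (∑< n (f ∘ suc) + f (suc n)) ≡⟨ sym (+-assoc (f 0) _ _) ⟩
    f 0 + ∑< n (f ∘ suc) + f (suc n)   ∎
    where
    rearrange : ∀ x y z → x + y + z ≡ z + (y + x)
    rearrange x y z = ≡.trans (+-comm (x + y) z) (cong (z +_) (+-comm x y))
  step : ∑[ j < n ] g (r + suc j) + g (r + 0) ≡ ∑[ j < n ] g (r + j) + g (r + 0)
  step = ≡.trans (shift-last n (λ j → g (r + j)))
           (cong (∑[ j < n ] g (r + j) +_) (≡.trans (periodic r) (cong g (sym (+-identityʳ r)))))

any< : ℕ → (ℕ → Bool) → Bool
any< zero q = false
any< (suc n) q = q 0 ∨ any< n (q ∘ suc)

any<-witness : ∀ n q → any< n q ≡ true → Σ ℕ λ t → t < n × q t ≡ true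
any<-witness (suc n) q e with q 0 in q0
... | true = 0 , s≤s z≤n , q0
... | false with any<-witness n (q ∘ suc) e
...   | t , t<n , qt = suc t , s≤s t<n , qt

any<-intro : ∀ n q {t} → t < n → q t ≡ true → any< n q ≡ true
any<-intro (suc n) q {zero} _ qt rewrite qt = refl
any<-intro (suc n) q {suc t} (s≤s t<n) qt rewrite any<-intro n (q ∘ suc) t<n qt = ∨-zeroʳ (q 0)

any<-cong : ∀ n {q q′ : ℕ → Bool} → q ≗ q′ → any< n q ≡ any< n q′
any<-cong zero e = refl
any<-cong (suc n) e = cong₂ _∨_ (e 0) (any<-cong n (e ∘ suc))

AtMostOne< : ℕ → (ℕ → Bool) → Set
AtMostOne< n q = ∀ {t t′} → t < n → t′ < n → q t ≡ true → q t′ ≡ true → t ≡ t′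

atMostOne-suc : ∀ n q → AtMostOne< (suc n) q → AtMostOne< n (q ∘ suc)
atMostOne-suc n q unique p p′ x y = suc-injective (unique (s≤s p) (s≤s p′) x y)

∑-indicator-atMostOne : ∀ n q → AtMostOne< n q → ∑[ t < n ] ⟦ q t ⟧ ≡ ⟦ any< n q ⟧
∑-indicator-atMostOne zero q _ = refl
∑-indicator-atMostOne (suc n) q unique with q 0 in q0
... | false = ∑-indicator-atMostOne n (q ∘ suc) (atMostOne-suc n q unique)
... | true = cong suc (≡.trans (∑-indicator-atMostOne n (q ∘ suc) (atMostOne-suc n q unique)) (cong ⟦_⟧ none))
  where
  none : any< n (q ∘ suc) ≡ false
  none with any< n (q ∘ suc) in e
  ... | false = refl
  ... | true with any<-witness n (q ∘ suc) e
  ...   | t , t<n , qt = ⊥-elim (1+n≢0 (sym (unique (s≤s z≤n) (s≤s t<n) q0 qt)))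

length-filter-applyUpTo : ∀ {A : Set} {P : A → Set} (P? : ∀ x → Dec (P x)) (g : ℕ → A) n →
                          length (filter P? (applyUpTo g n)) ≡ ∑[ i < n ] ⟦ does (P? (g i)) ⟧
length-filter-applyUpTo P? g zero = refl
length-filter-applyUpTo P? g (suc n) with does (P? (g 0))
... | true = cong suc (length-filter-applyUpTo P? (g ∘ suc) n)
... | false = length-filter-applyUpTo P? (g ∘ suc) n

first< : ℕ → (ℕ → Bool) → Maybe ℕ
first< zero q = nothing
first< (suc n) q = if q 0 then just 0 else Maybe.map suc (first< n (q ∘ suc))

first<-just : ∀ n q {u} → first< n q ≡ just u → u < n × q u ≡ true
first<-just (suc n) q e with q 0 in q0
first<-just (suc n) q refl | true = s≤s z≤n , q0
... | false with first< n (q ∘ suc) in e′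
first<-just (suc n) q refl | false | just u with first<-just n (q ∘ suc) e′
... | u<n , qu = s≤s u<n , qu

first<-nothing : ∀ n q → first< n q ≡ nothing → ∀ x → x < n → q x ≡ false
first<-nothing (suc n) q e x x<n with q 0 in q0
first<-nothing (suc n) q () x x<n | true
... | false with first< n (q ∘ suc) in e′
first<-nothing (suc n) q e zero _ | false | nothing = q0
first<-nothing (suc n) q e (suc x) (s≤s x<n) | false | nothing = first<-nothing n (q ∘ suc) e′ x x<n
first<-nothing (suc n) q () x x<n | false | just _

first<-cong : ∀ n {q q′ : ℕ → Bool} → q ≗ q′ → first< n q ≡ first< n q′
first<-cong zero e = refl
first<-cong (suc n) e rewrite e 0 | first<-cong n (e ∘ suc) = refl

∑Fin : (n : ℕ) → (Fin n → ℕ) → ℕ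
∑Fin zero g = 0
∑Fin (suc n) g = g Fin.zero + ∑Fin n (g ∘ Fin.suc)

∑Fin-cong : ∀ n {g g′ : Fin n → ℕ} → g ≗ g′ → ∑Fin n g ≡ ∑Fin n g′
∑Fin-cong zero e = refl
∑Fin-cong (suc n) e = cong₂ _+_ (e Fin.zero) (∑Fin-cong n (e ∘ Fin.suc))

∑Fin-toℕ : ∀ n (g : ℕ → ℕ) → ∑Fin n (g ∘ Fin.toℕ) ≡ ∑< n g
∑Fin-toℕ zero g = refl
∑Fin-toℕ (suc n) g = cong (g 0 +_) (∑Fin-toℕ n (g ∘ suc))

length-filter-tabulate : ∀ {A : Set} {P : A → Set} (P? : ∀ x → Dec (P x)) n (f : Fin n → A) →
                         length (filter P? (List.tabulate f)) ≡ ∑Fin n (λ i → ⟦ does (P? (f i)) ⟧)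
length-filter-tabulate P? zero f = refl
length-filter-tabulate P? (suc n) f with does (P? (f Fin.zero))
... | true = cong suc (length-filter-tabulate P? n (f ∘ Fin.suc))
... | false = length-filter-tabulate P? n (f ∘ Fin.suc)

sum-map-tabulate : ∀ n {A : Set} (g : A → ℕ) (f : Fin n → A) → sum (map g (List.tabulate f)) ≡ ∑Fin n (g ∘ f)
sum-map-tabulate zero g f = refl
sum-map-tabulate (suc n) g f = cong (g (f Fin.zero) +_) (sum-map-tabulate n g (f ∘ Fin.suc))

module _ {A : Set} where

  Unique-⊆⇒length≤ : (xs ys : List A) → Unique xs → (∀ {z} → z ∈ xs → z ∈ ys) → length xs ≤ length ys
  Unique-⊆⇒length≤ [] ys _ _ = z≤n
  Unique-⊆⇒length≤ (x ∷ xs) ys (x∉xs ∷ unique) sub with ∈-∃++ (sub (here refl))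
  ... | us , vs , refl =
    subst (suc (length xs) ≤_) (sym (≡.trans (length-++ us) (+-suc (length us) (length vs))))
      (s≤s (subst (length xs ≤_) (length-++ us) (Unique-⊆⇒length≤ xs (us ++ vs) unique sub′)))
    where
    sub′ : ∀ {z} → z ∈ xs → z ∈ us ++ vs
    sub′ {z} z∈xs with ∈-++⁻ us (sub (there z∈xs))
    ... | inj₁ p = ∈-++⁺ˡ p
    ... | inj₂ (here z≡x) = ⊥-elim (All.lookup x∉xs z∈xs (sym z≡x))
    ... | inj₂ (there p) = ∈-++⁺ʳ us p

module _ {A B : Set} (f : A → B) where

  map⁺-injectiveOn : (xs : List A) → (∀ {x y} → x ∈ xs → y ∈ xs → f x ≡ f y → x ≡ y) →
                     Unique xs → Unique (map f xs)
  map⁺-injectiveOn [] _ _ = []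
  map⁺-injectiveOn (x ∷ xs) inj (x∉xs ∷ unique) =
    distinct xs (λ y∈ys → there y∈ys) x∉xs ∷ map⁺-injectiveOn xs (λ p q → inj (there p) (there q)) unique
    where
    distinct : ∀ ys → (∀ {y} → y ∈ ys → y ∈ x ∷ xs) → All (x ≢_) ys → All (f x ≢_) (map f ys)
    distinct [] _ [] = []
    distinct (y ∷ ys) sub (x≢y ∷ rest) =
      (λ fx≡fy → x≢y (inj (here refl) (sub (here refl)) fx≡fy)) ∷ distinct ys (sub ∘ there) rest

  length≤-by-injection : (P : A → Set) (Q : B → Set) (xs : List A) (ys : List B) →
    Unique xs → (∀ {x} → x ∈ xs → P x) → (∀ {y} → Q y → y ∈ ys) →
    (∀ x → P x → Q (f x)) → (∀ {x y} → P x → P y → f x ≡ f y → x ≡ y) →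
    length xs ≤ length ys
  length≤-by-injection P Q xs ys unique inP inYs maps inj =
    subst (_≤ length ys) (length-map f xs)
      (Unique-⊆⇒length≤ (map f xs) ys
        (map⁺-injectiveOn xs (λ p q → inj (inP p) (inP q)) unique) sub)
    where
    sub : ∀ {z} → z ∈ map f xs → z ∈ ys
    sub z∈ with ∈-map⁻ f z∈
    ... | x , x∈xs , refl = inYs (maps x (inP x∈xs))

≡ᵇ-refl : ∀ x → (x ≡ᵇ x) ≡ true
≡ᵇ-refl x = dec-true (x ≟ x) refl

≢⇒≡ᵇ-false : ∀ {x y} → x ≢ y → (x ≡ᵇ y) ≡ false
≢⇒≡ᵇ-false {x} {y} = dec-false (x ≟ y)

occurrences : ℕ → List ℕ → ℕ
occurrences z [] = 0
occurrences z (x ∷ xs) = ⟦ x ≡ᵇ z ⟧ + occurrences z xs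

occurrences-++ : ∀ z us vs → occurrences z (us ++ vs) ≡ occurrences z us + occurrences z vs
occurrences-++ z [] vs = refl
occurrences-++ z (u ∷ us) vs =
  ≡.trans (cong (⟦ u ≡ᵇ z ⟧ +_) (occurrences-++ z us vs)) (sym (+-assoc ⟦ u ≡ᵇ z ⟧ _ _))

occurrences-applyUpTo : ∀ z (f : ℕ → ℕ) n → occurrences z (applyUpTo f n) ≡ ∑[ i < n ] ⟦ f i ≡ᵇ z ⟧
occurrences-applyUpTo z f zero = refl
occurrences-applyUpTo z f (suc n) = cong (⟦ f 0 ≡ᵇ z ⟧ +_) (occurrences-applyUpTo z (f ∘ suc) n)

occurrences>0⇒∈ : ∀ z xs → 0 < occurrences z xs → z ∈ xs
occurrences>0⇒∈ z (x ∷ xs) p with x ≡ᵇ z in e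
... | true = here (sym (≡ᵇ⇒≡ x z (subst T (sym e) _)))
... | false = there (occurrences>0⇒∈ z xs p)

occurrences⇒↭ : (xs ys : List ℕ) → (∀ z → occurrences z xs ≡ occurrences z ys) → xs ↭ ys
occurrences⇒↭ [] [] _ = refl
occurrences⇒↭ [] (y ∷ ys) same = ⊥-elim (1+n≢0 (sym (≡.trans (same y) (cong (λ b → ⟦ b ⟧ + occurrences y ys) (≡ᵇ-refl y)))))
occurrences⇒↭ (x ∷ xs) ys same with ∈-∃++ (occurrences>0⇒∈ x ys (subst (0 <_) (same x) x-occurs))
  where
  x-occurs : 0 < occurrences x (x ∷ xs)
  x-occurs = subst (λ b → 0 < ⟦ b ⟧ + occurrences x xs) (sym (≡ᵇ-refl x)) (s≤s z≤n)
... | us , vs , refl = trans (prep x (occurrences⇒↭ xs (us ++ vs) same′)) (↭-sym (↭-shift x us vs))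
  where
  same′ : ∀ z → occurrences z xs ≡ occurrences z (us ++ vs)
  same′ z = +-cancelˡ-≡ ⟦ x ≡ᵇ z ⟧ _ _ (begin
    ⟦ x ≡ᵇ z ⟧ + occurrences z xs                       ≡⟨ same z ⟩
    occurrences z (us ++ x ∷ vs)                        ≡⟨ occurrences-++ z us (x ∷ vs) ⟩
    occurrences z us + (⟦ x ≡ᵇ z ⟧ + occurrences z vs)  ≡⟨ x∙yz≈y∙xz +-commutativeSemigroup (occurrences z us) ⟦ x ≡ᵇ z ⟧ (occurrences z vs) ⟩
    ⟦ x ≡ᵇ z ⟧ + (occurrences z us + occurrences z vs)  ≡⟨ cong (⟦ x ≡ᵇ z ⟧ +_) (occurrences-++ z us vs) ⟨
    ⟦ x ≡ᵇ z ⟧ + occurrences z (us ++ vs)               ∎)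
    where open ≡-Reasoning

-- Reduction to transpositions of adjacent colours

adjSwap : ℕ → ℕ → ℕ
adjSwap zero zero = 1
adjSwap zero (suc zero) = 0
adjSwap zero (suc (suc y)) = suc (suc y)
adjSwap (suc c) zero = zero
adjSwap (suc c) (suc y) = suc (adjSwap c y)

lookup₀ : List ℕ → ℕ → ℕ
lookup₀ [] _ = 0
lookup₀ (x ∷ xs) zero = x
lookup₀ (x ∷ xs) (suc i) = lookup₀ xs i

lookup₀-adjSwap : ∀ pre x y r → lookup₀ (pre ++ x ∷ y ∷ r) ∘ adjSwap (length pre) ≗ lookup₀ (pre ++ y ∷ x ∷ r)
lookup₀-adjSwap [] x y r zero = refl
lookup₀-adjSwap [] x y r (suc zero) = refl
lookup₀-adjSwap [] x y r (suc (suc i)) = refl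
lookup₀-adjSwap (p ∷ pre) x y r zero = refl
lookup₀-adjSwap (p ∷ pre) x y r (suc i) = lookup₀-adjSwap pre x y r i

ZeroFrom : ℕ → (ℕ → ℕ) → Set
ZeroFrom B g = ∀ i → B ≤ i → g i ≡ 0

lookup₀-applyUpTo : ∀ (g : ℕ → ℕ) B → ZeroFrom B g → g ≗ lookup₀ (applyUpTo g B)
lookup₀-applyUpTo g B zero-from i with B ≤? i
... | yes B≤i = ≡.trans (zero-from i B≤i) (sym (beyond g B B≤i))
  where
  beyond : ∀ g B {i} → B ≤ i → lookup₀ (applyUpTo g B) i ≡ 0
  beyond g zero _ = refl
  beyond g (suc B) (s≤s B≤i) = beyond (g ∘ suc) B B≤i
... | no B≰i = sym (within g B (≰⇒> B≰i))
  where
  within : ∀ g B {i} → i < B → lookup₀ (applyUpTo g B) i ≡ g i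
  within g (suc B) {zero} _ = refl
  within g (suc B) {suc i} (s≤s i<B) = within (g ∘ suc) B i<B

-- On [0, B) the values of α and α ∘ t form the same multiset: t and u inject the positions carrying
-- a given nonzero value into each other, and the zeros fill the rest.
module FinitaryPermutation (α t u : ℕ → ℕ) (t∘u : ∀ x → t (u x) ≡ x) (u∘t : ∀ x → u (t x) ≡ x)
                           (B : ℕ) (α-zero : ZeroFrom B α) (α∘t-zero : ZeroFrom B (α ∘ t)) where

  module _ (R : ℕ → Set) (R? : ∀ v → Dec (R v)) (¬R0 : ¬ R 0) where

    indices : (ℕ → ℕ) → List ℕ
    indices g = filter (R? ∘ g) (upTo B)

    ∈-indices : ∀ g → ZeroFrom B g → ∀ {i} → R (g i) → i ∈ indices g
    ∈-indices g zero-from {i} r = ∈-filter⁺ (R? ∘ g) (∈-upTo⁺ i<B) r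
      where
      i<B : i < B
      i<B with B ≤? i
      ... | yes B≤i = ⊥-elim (¬R0 (subst R (zero-from i B≤i) r))
      ... | no B≰i = ≰⇒> B≰i

    indices-R : ∀ g {i} → i ∈ indices g → R (g i)
    indices-R g p = proj₂ (∈-filter⁻ (R? ∘ g) {xs = upTo B} p)

    unique-indices : ∀ g → Unique (indices g)
    unique-indices g = filter⁺ (R? ∘ g) (upTo⁺ B)

    count-invariant : ∑[ i < B ] ⟦ does (R? (α i)) ⟧ ≡ ∑[ i < B ] ⟦ does (R? (α (t i))) ⟧
    count-invariant = begin
      ∑[ i < B ] ⟦ does (R? (α i)) ⟧      ≡⟨ sym (length-filter-applyUpTo (R? ∘ α) id B) ⟩
      length (indices α)                  ≡⟨ ≤-antisym forward backward ⟩
      length (indices (α ∘ t))            ≡⟨ length-filter-applyUpTo (R? ∘ α ∘ t) id B ⟩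
      ∑[ i < B ] ⟦ does (R? (α (t i))) ⟧  ∎
      where
      open ≡-Reasoning
      forward = length≤-by-injection u (R ∘ α) (R ∘ α ∘ t) _ _ (unique-indices α)
                  (indices-R α) (∈-indices (α ∘ t) α∘t-zero)
                  (λ x r → subst R (cong α (sym (t∘u x))) r)
                  (λ {x} {y} _ _ e → ≡.trans (sym (t∘u x)) (≡.trans (cong t e) (t∘u y)))
      backward = length≤-by-injection t (R ∘ α ∘ t) (R ∘ α) _ _ (unique-indices (α ∘ t))
                   (indices-R (α ∘ t)) (∈-indices α α-zero) (λ x r → r)
                   (λ {x} {y} _ _ e → ≡.trans (sym (u∘t x)) (≡.trans (cong u e) (u∘t y)))

  nonzero? : ∀ v → Dec (v ≢ 0)
  nonzero? zero = no (λ v≢0 → v≢0 refl)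
  nonzero? (suc v) = yes (λ ())

  occurrences-invariant : ∀ z → occurrences z (applyUpTo α B) ≡ occurrences z (applyUpTo (α ∘ t) B)
  occurrences-invariant (suc z) = begin
    occurrences (suc z) (applyUpTo α B)       ≡⟨ occurrences-applyUpTo (suc z) α B ⟩
    ∑[ i < B ] ⟦ α i ≡ᵇ suc z ⟧               ≡⟨ count-invariant (_≡ suc z) (_≟ suc z) (λ ()) ⟩
    ∑[ i < B ] ⟦ α (t i) ≡ᵇ suc z ⟧           ≡⟨ sym (occurrences-applyUpTo (suc z) (α ∘ t) B) ⟩
    occurrences (suc z) (applyUpTo (α ∘ t) B) ∎
    where open ≡-Reasoning
  occurrences-invariant zero = begin
    occurrences 0 (applyUpTo α B)       ≡⟨ occurrences-applyUpTo 0 α B ⟩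
    zeros α                             ≡⟨ +-cancelʳ-≡ (nonzeros α) _ _ zeros+nonzeros ⟩
    zeros (α ∘ t)                       ≡⟨ sym (occurrences-applyUpTo 0 (α ∘ t) B) ⟩
    occurrences 0 (applyUpTo (α ∘ t) B) ∎
    where
    open ≡-Reasoning
    zeros nonzeros : (ℕ → ℕ) → ℕ
    zeros g = ∑[ i < B ] ⟦ g i ≡ᵇ 0 ⟧
    nonzeros g = ∑[ i < B ] ⟦ does (nonzero? (g i)) ⟧
    total : ∀ g → zeros g + nonzeros g ≡ B
    total g = ≡.trans (sym (∑-distrib-+ B _ _)) (∑-one B _ (λ i → split (g i)))
      where
      split : ∀ v → ⟦ v ≡ᵇ 0 ⟧ + ⟦ does (nonzero? v) ⟧ ≡ 1
      split zero = refl
      split (suc v) = refl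
    zeros+nonzeros : zeros α + nonzeros α ≡ zeros (α ∘ t) + nonzeros α
    zeros+nonzeros = ≡.trans (total α) (≡.trans (sym (total (α ∘ t)))
                       (cong (zeros (α ∘ t) +_) (sym (count-invariant (_≢ 0) nonzero? (λ 0≢0 → 0≢0 refl)))))

  values-↭ : applyUpTo α B ↭ applyUpTo (α ∘ t) B
  values-↭ = occurrences⇒↭ _ _ occurrences-invariant

module ContentInjections {X : Set} (S : (ℕ → ℕ) → X → Set)
                         (S-cong : ∀ {α β} → α ≗ β → ∀ {x} → S α x → S β x) where

  _≼_ : (ℕ → ℕ) → (ℕ → ℕ) → Set
  α ≼ β = Σ (X → X) λ f → (∀ {x} → S α x → S β (f x)) × (∀ {x y} → S α x → S α y → f x ≡ f y → x ≡ y)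

  ≼-trans : ∀ {α β γ} → α ≼ β → β ≼ γ → α ≼ γ
  ≼-trans (f , f-maps , f-inj) (g , g-maps , g-inj) =
    g ∘ f , g-maps ∘ f-maps , λ sx sy e → f-inj sx sy (g-inj (f-maps sx) (f-maps sy) e)

  ≗⇒≼ : ∀ {α β} → α ≗ β → α ≼ β
  ≗⇒≼ α≗β = id , S-cong α≗β , λ _ _ e → e

  module _ (≼-adjSwap : ∀ c α → α ≼ (α ∘ adjSwap c)) where

    ↭⇒≼ : ∀ {xs ys} → xs ↭ ys → ∀ pre {α β} → α ≗ lookup₀ (pre ++ xs) → β ≗ lookup₀ (pre ++ ys) → α ≼ β
    ↭⇒≼ refl pre eα eβ = ≗⇒≼ (λ i → ≡.trans (eα i) (sym (eβ i)))
    ↭⇒≼ (prep {xs} {ys} x p) pre eα eβ =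
      ↭⇒≼ p (pre ++ [ x ]) (λ i → ≡.trans (eα i) (cong (λ l → lookup₀ l i) (sym (++-assoc pre [ x ] xs))))
                           (λ i → ≡.trans (eβ i) (cong (λ l → lookup₀ l i) (sym (++-assoc pre [ x ] ys))))
    ↭⇒≼ (swap {xs} {ys} x y p) pre {α} eα eβ =
      ≼-trans (≼-adjSwap (length pre) α)
        (↭⇒≼ p (pre ++ y ∷ x ∷ [])
          (λ i → ≡.trans (eα (adjSwap (length pre) i)) (≡.trans (lookup₀-adjSwap pre x y xs i)
                   (cong (λ l → lookup₀ l i) (sym (++-assoc pre (y ∷ x ∷ []) xs)))))
          (λ i → ≡.trans (eβ i) (cong (λ l → lookup₀ l i) (sym (++-assoc pre (y ∷ x ∷ []) ys)))))
    ↭⇒≼ (trans {xs} {ys} p q) pre eα eβ =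
      ≼-trans (↭⇒≼ p pre eα (λ _ → refl)) (↭⇒≼ q pre {lookup₀ (pre ++ ys)} (λ _ → refl) eβ)

    ≼-permute : ∀ α (t u : ℕ → ℕ) → (∀ x → t (u x) ≡ x) → (∀ x → u (t x) ≡ x) →
                ∀ B → ZeroFrom B α → ZeroFrom B (α ∘ t) → α ≼ (α ∘ t)
    ≼-permute α t u t∘u u∘t B α-zero α∘t-zero =
      ↭⇒≼ (FinitaryPermutation.values-↭ α t u t∘u u∘t B α-zero α∘t-zero) []
        (lookup₀-applyUpTo α B α-zero) (lookup₀-applyUpTo (α ∘ t) B α∘t-zero)

-- Runs of marked positions

-- The variables stand for marked, linked, colour, parityBefore, lastColour and flipAt at a
-- position j, and for flipAt at j + 1; these are the telescoping steps of the two balances below.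
balance₁ : (h b c l p d d′ : Bool) →
  (h ∧ not b ≡ false → d′ ≡ d) → (h ∧ not b ≡ true → d ≡ not l) → (h ≡ true → l ≡ true → c ≡ not p) →
  let l′ = if h ∧ not b then false else h xor l
      p′ = if h then c else p in
  ⟦ h ∧ not (c xor d) ⟧ + ⟦ l′ ∧ not d′ ∧ p′ ⟧ + ⟦ l ∧ not d ∧ not p ⟧ ≡
  ⟦ h ∧ c ⟧ + ⟦ l ∧ not d ∧ p ⟧ + ⟦ l′ ∧ not d′ ∧ not p′ ⟧
balance₁ false b c l p d d′ linked _ _ rewrite linked refl = refl
balance₁ true true c true p d d′ _ _ alternate rewrite alternate refl refl with p | d
... | true | true = refl
... | true | false = refl
... | false | true = refl
... | false | false = refl
balance₁ true true c false p d d′ linked _ _ rewrite linked refl with c | d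
... | true | true = refl
... | true | false = refl
... | false | true = refl
... | false | false = refl
balance₁ true false c true p d d′ _ end alternate rewrite end refl | alternate refl refl with p
... | true = refl
... | false = refl
balance₁ true false c false p d d′ _ end _ rewrite end refl with c
... | true = refl
... | false = refl

balance₂ : (h b c l p d d′ : Bool) →
  (h ∧ not b ≡ false → d′ ≡ d) → (h ∧ not b ≡ true → d ≡ not l) → (h ≡ true → l ≡ true → c ≡ not p) →
  let l′ = if h ∧ not b then false else h xor l
      p′ = if h then c else p in
  ⟦ h ∧ b ∧ not (c xor d) ⟧ + ⟦ l′ ∧ d′ ∧ not p′ ⟧ + ⟦ l ∧ d ∧ p ⟧ ≡
  ⟦ h ∧ b ∧ not c ⟧ + ⟦ l ∧ d ∧ not p ⟧ + ⟦ l′ ∧ d′ ∧ p′ ⟧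
balance₂ false b c l p d d′ linked _ _ rewrite linked refl = refl
balance₂ true true c true p d d′ _ _ alternate rewrite alternate refl refl with p | d
... | true | true = refl
... | true | false = refl
... | false | true = refl
... | false | false = refl
balance₂ true true c false p d d′ linked _ _ rewrite linked refl with c | d
... | true | true = refl
... | true | false = refl
... | false | true = refl
... | false | false = refl
balance₂ true false c true p d d′ _ end _ rewrite end refl = refl
balance₂ true false c false p d d′ _ end _ rewrite end refl = refl

n∸j≡suc[n∸suc-j] : ∀ n j → j < n → n ∸ j ≡ suc (n ∸ suc j)
n∸j≡suc[n∸suc-j] (suc n) zero _ = refl
n∸j≡suc[n∸suc-j] (suc n) (suc j) (s≤s j<n) = n∸j≡suc[n∸suc-j] n j j<n

module Runs (n : ℕ) (marked linked : ℕ → Bool) where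

  runEnd : ℕ → Bool
  runEnd j = marked j ∧ not (linked j)

  parityBefore : ℕ → Bool
  parityBefore zero = false
  parityBefore (suc j) = if runEnd j then false else (marked j xor parityBefore j)

  inRun : ℕ → Bool
  inRun zero = false
  inRun (suc j) = if runEnd j then false else (marked j ∨ inRun j)

  parityWithin : ℕ → ℕ → Bool
  parityWithin zero j = false
  parityWithin (suc k) j = if runEnd j then true else (marked j xor parityWithin k (suc j))

  parityFrom : ℕ → Bool
  parityFrom j = parityWithin (n ∸ j) j

  -- At a marked position j, parityBefore j and parityFrom j together count the run through j,
  -- so flipAt j says whether that run has odd length.
  flipAt : ℕ → Bool
  flipAt j = parityBefore j xor parityFrom j

  parityFrom-step : ∀ j → j < n → parityFrom j ≡ (if runEnd j then true else (marked j xor parityFrom (suc j)))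
  parityFrom-step j j<n rewrite n∸j≡suc[n∸suc-j] n j j<n = refl

  flipAt-step : ∀ j → j < n → runEnd j ≡ false → flipAt (suc j) ≡ flipAt j
  flipAt-step j j<n ¬end rewrite parityFrom-step j j<n | ¬end = xor-shuffle (marked j) (parityBefore j) (parityFrom (suc j))
    where
    xor-shuffle : ∀ x y z → (x xor y) xor z ≡ y xor (x xor z)
    xor-shuffle true true z = sym (not-involutive z)
    xor-shuffle true false z = refl
    xor-shuffle false y z = refl

  flipAt-runEnd : ∀ j → j < n → runEnd j ≡ true → flipAt j ≡ not (parityBefore j)
  flipAt-runEnd j j<n end rewrite parityFrom-step j j<n | end = xor-comm (parityBefore j) true

  runEnd-linked : ∀ {j} → marked j ≡ true → linked j ≡ true → runEnd j ≡ false
  runEnd-linked m l rewrite m | l = refl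

  runEnd-unmarked : ∀ {j} → marked j ≡ false → runEnd j ≡ false
  runEnd-unmarked m rewrite m = refl

  flipAt-across-gap : ∀ j j′ → marked j ≡ true → linked j ≡ true → j < j′ → j′ < n →
                      (∀ t → j < t → t < j′ → marked t ≡ false) → flipAt j′ ≡ flipAt j
  flipAt-across-gap j j′ mj lj j<j′ j′<n gap =
    subst (λ t → flipAt t ≡ flipAt j) (m+[n∸m]≡n j<j′) (go (j′ ∸ suc j) (≤-reflexive (m+[n∸m]≡n j<j′)))
    where
    go : ∀ k → suc j + k ≤ j′ → flipAt (suc j + k) ≡ flipAt j
    go zero _ = subst (λ t → flipAt t ≡ flipAt j) (sym (+-identityʳ (suc j)))
                  (flipAt-step j (<-trans j<j′ j′<n) (runEnd-linked mj lj))
    go (suc k) p = ≡.trans (cong flipAt (+-suc (suc j) k))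
      (≡.trans (flipAt-step (suc j + k) (<-≤-trans p′ (<⇒≤ j′<n))
                  (runEnd-unmarked (gap (suc j + k) (s≤s (m≤m+n j k)) p′)))
               (go k (≤-trans (+-monoʳ-≤ (suc j) (n≤1+n k)) p)))
      where
      p′ : suc j + k < j′
      p′ = subst (_≤ j′) (+-suc (suc j) k) p

  flipAt-constant : (∀ j → j < n → runEnd j ≡ false) → ∀ j → j ≤ n → flipAt j ≡ flipAt 0
  flipAt-constant noEnd zero _ = refl
  flipAt-constant noEnd (suc j) j<n = ≡.trans (flipAt-step j j<n (noEnd j j<n)) (flipAt-constant noEnd j (<⇒≤ j<n))

  parityBefore⇒inRun : ∀ j → parityBefore j ≡ true → inRun j ≡ true
  parityBefore⇒inRun (suc j) p with runEnd j
  ... | false with marked j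
  ...   | true = refl
  ...   | false = parityBefore⇒inRun j p

  module Coloured (colour : ℕ → Bool) where

    lastColour : ℕ → Bool
    lastColour zero = false
    lastColour (suc j) = if marked j then colour j else lastColour j

    runStartColour : ℕ → Bool
    runStartColour zero = false
    runStartColour (suc j) = if inRun j then runStartColour j else colour j

    Alternating : Set
    Alternating = ∀ j → j < n → marked j ≡ true → inRun j ≡ true → colour j ≡ not (lastColour j)

    inRun-witness : ∀ j → inRun j ≡ true →
      Σ ℕ λ i → i < j × marked i ≡ true × linked i ≡ true × lastColour j ≡ colour i ×
                (∀ t → i < t → t < j → marked t ≡ false)
    inRun-witness (suc j) e with marked j in mj | linked j in lj
    ... | true | true = j , ≤-refl , mj , lj , refl , λ t j<t t<1+j → ⊥-elim (<-irrefl refl (<-≤-trans j<t (≤-pred t<1+j)))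
    ... | false | _ with inRun-witness j e
    ...   | i , i<j , mi , li , last , gap = i , <-trans i<j ≤-refl , mi , li , last , gap′
      where
      gap′ : ∀ t → i < t → t < suc j → marked t ≡ false
      gap′ t i<t t<1+j with m≤n⇒m<n∨m≡n (≤-pred t<1+j)
      ... | inj₁ t<j = gap t i<t t<j
      ... | inj₂ refl = mj

    module WithoutRunEnds (noEnd : ∀ j → j < n → runEnd j ≡ false) (alternating : Alternating) where

      parity-invariant : ∀ j → j ≤ n →
        (inRun j ≡ false → parityBefore j ≡ false) ×
        (inRun j ≡ true → lastColour j ≡ runStartColour j xor not (parityBefore j))
      parity-invariant zero _ = (λ _ → refl) , λ ()
      parity-invariant (suc j) j<n rewrite noEnd j j<n with marked j in mj | inRun j in rj
      ... | true | true = (λ ()) , λ _ →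
        ≡.trans (alternating j j<n mj rj)
          (≡.trans (cong not (proj₂ (parity-invariant j (<⇒≤ j<n)) rj)) (not-xor-not (runStartColour j) (parityBefore j)))
        where
        not-xor-not : ∀ g l → not (g xor not l) ≡ g xor not (not l)
        not-xor-not true l = refl
        not-xor-not false l = refl
      ... | true | false rewrite proj₁ (parity-invariant j (<⇒≤ j<n)) rj = (λ ()) , λ _ → sym (xor-identityʳ (colour j))
      ... | false | false = (λ _ → proj₁ (parity-invariant j (<⇒≤ j<n)) rj) , λ ()
      ... | false | true = (λ ()) , λ _ → proj₂ (parity-invariant j (<⇒≤ j<n)) rj

      unmarked-before : ∀ j → j ≤ n → inRun j ≡ false → ∀ t → t < j → marked t ≡ false
      unmarked-before (suc j) j<n e t t<1+j rewrite noEnd j j<n with marked j in mj | inRun j in rj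
      unmarked-before (suc j) j<n () t t<1+j | true | _
      ... | false | true = ⊥-elim (true≢false e)
      ... | false | false with m≤n⇒m<n∨m≡n (≤-pred t<1+j)
      ...   | inj₁ t<j = unmarked-before j (<⇒≤ j<n) rj t t<j
      ...   | inj₂ refl = mj

      runStart-witness : ∀ j → j ≤ n → inRun j ≡ true →
        Σ ℕ λ i → i < j × marked i ≡ true × runStartColour j ≡ colour i × (∀ t → t < i → marked t ≡ false)
      runStart-witness (suc j) j<n e rewrite noEnd j j<n with inRun j in rj
      ... | true with runStart-witness j (<⇒≤ j<n) rj
      ...   | i , i<j , mi , start , gap = i , <-trans i<j ≤-refl , mi , start , gap
      runStart-witness (suc j) j<n e | false with marked j in mj
      ...   | true = j , ≤-refl , mj , refl , unmarked-before j (<⇒≤ j<n) rj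
      ...   | false = ⊥-elim (true≢false (sym e))

      parityBefore-closes : (inRun n ≡ true → lastColour n ≡ not (runStartColour n)) → parityBefore n ≡ false
      parityBefore-closes wraps with inRun n in rn
      ... | false = proj₁ (parity-invariant n ≤-refl) rn
      ... | true with parityBefore n in pn
      ...   | false = refl
      ...   | true = ⊥-elim (x≢not-x (runStartColour n)
                       (≡.trans (sym (xor-identityʳ (runStartColour n)))
                         (≡.trans (sym (subst (λ l → lastColour n ≡ runStartColour n xor not l) pn
                                          (proj₂ (parity-invariant n ≤-refl) rn)))
                                  (wraps refl))))
        where
        x≢not-x : ∀ x → x ≢ not x
        x≢not-x true ()
        x≢not-x false ()

    -- Both balances telescope: the potentials u and v measure the imbalance between the two colours in
    -- the part of the current run seen so far, which vanishes again at the end of the run.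
    module Balanced (alternating : Alternating) (closed : parityBefore n ≡ false) where

      flip-balance : ∑[ j < n ] ⟦ marked j ∧ not (colour j xor flipAt j) ⟧ ≡ ∑[ j < n ] ⟦ marked j ∧ colour j ⟧
      flip-balance = +-cancelʳ-≡ 0 _ _ (+-cancelʳ-≡ 0 _ _ (subst
        (λ l → ∑< n f + ⟦ l ∧ not (flipAt n) ∧ lastColour n ⟧ + 0 ≡ ∑< n g + 0 + ⟦ l ∧ not (flipAt n) ∧ not (lastColour n) ⟧)
        closed (∑-telescope n f g u v step)))
        where
        f g u v : ℕ → ℕ
        f j = ⟦ marked j ∧ not (colour j xor flipAt j) ⟧
        g j = ⟦ marked j ∧ colour j ⟧
        u j = ⟦ parityBefore j ∧ not (flipAt j) ∧ lastColour j ⟧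
        v j = ⟦ parityBefore j ∧ not (flipAt j) ∧ not (lastColour j) ⟧
        step : ∀ j → j < n → f j + u (suc j) + v j ≡ g j + u j + v (suc j)
        step j j<n = balance₁ (marked j) (linked j) (colour j) (parityBefore j) (lastColour j) (flipAt j) (flipAt (suc j))
                       (flipAt-step j j<n) (flipAt-runEnd j j<n) (λ mj pj → alternating j j<n mj (parityBefore⇒inRun j pj))

      linked-flip-balance : ∑[ j < n ] ⟦ marked j ∧ linked j ∧ not (colour j xor flipAt j) ⟧ ≡
                            ∑[ j < n ] ⟦ marked j ∧ linked j ∧ not (colour j) ⟧
      linked-flip-balance = +-cancelʳ-≡ 0 _ _ (+-cancelʳ-≡ 0 _ _ (subst
        (λ l → ∑< n f + ⟦ l ∧ flipAt n ∧ not (lastColour n) ⟧ + 0 ≡ ∑< n g + 0 + ⟦ l ∧ flipAt n ∧ lastColour n ⟧)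
        closed (∑-telescope n f g u v step)))
        where
        f g u v : ℕ → ℕ
        f j = ⟦ marked j ∧ linked j ∧ not (colour j xor flipAt j) ⟧
        g j = ⟦ marked j ∧ linked j ∧ not (colour j) ⟧
        u j = ⟦ parityBefore j ∧ flipAt j ∧ not (lastColour j) ⟧
        v j = ⟦ parityBefore j ∧ flipAt j ∧ lastColour j ⟧
        step : ∀ j → j < n → f j + u (suc j) + v j ≡ g j + u j + v (suc j)
        step j j<n = balance₂ (marked j) (linked j) (colour j) (parityBefore j) (lastColour j) (flipAt j) (flipAt (suc j))
                       (flipAt-step j j<n) (flipAt-runEnd j j<n) (λ mj pj → alternating j j<n mj (parityBefore⇒inRun j pj))

module _ (n : ℕ) {marked linked marked′ linked′ : ℕ → Bool} (m≗ : marked ≗ marked′) (l≗ : linked ≗ linked′) where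
  open Runs n

  parityBefore-cong : parityBefore marked linked ≗ parityBefore marked′ linked′
  parityBefore-cong zero = refl
  parityBefore-cong (suc j) rewrite m≗ j | l≗ j | parityBefore-cong j = refl

  parityWithin-cong : ∀ k → parityWithin marked linked k ≗ parityWithin marked′ linked′ k
  parityWithin-cong zero j = refl
  parityWithin-cong (suc k) j rewrite m≗ j | l≗ j | parityWithin-cong k (suc j) = refl

  flipAt-cong : flipAt marked linked ≗ flipAt marked′ linked′
  flipAt-cong j = cong₂ _xor_ (parityBefore-cong j) (parityWithin-cong (n ∸ j) j)

-- Two adjacent colours

adjSwap-lower : ∀ c → adjSwap c c ≡ suc c
adjSwap-lower zero = refl
adjSwap-lower (suc c) = cong suc (adjSwap-lower c)

adjSwap-upper : ∀ c → adjSwap c (suc c) ≡ c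
adjSwap-upper zero = refl
adjSwap-upper (suc c) = cong suc (adjSwap-upper c)

adjSwap-other : ∀ c {u} → u ≢ c → u ≢ suc c → adjSwap c u ≡ u
adjSwap-other zero {zero} u≢c _ = ⊥-elim (u≢c refl)
adjSwap-other zero {suc zero} _ u≢1+c = ⊥-elim (u≢1+c refl)
adjSwap-other zero {suc (suc u)} _ _ = refl
adjSwap-other (suc c) {zero} _ _ = refl
adjSwap-other (suc c) {suc u} u≢c u≢1+c = cong suc (adjSwap-other c (u≢c ∘′ cong suc) (u≢1+c ∘′ cong suc))

module AdjacentColours (c : ℕ) where

  isPair : ℕ → Bool
  isPair y = (y ≡ᵇ c) ∨ (y ≡ᵇ suc c)

  isUpper : ℕ → Bool
  isUpper y = y ≡ᵇ suc c

  data PairView (u : ℕ) : Set where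
    lower : u ≡ c → PairView u
    upper : u ≡ suc c → PairView u
    other : u ≢ c → u ≢ suc c → PairView u

  pairView : ∀ u → PairView u
  pairView u with u ≟ c
  ... | yes u≡c = lower u≡c
  ... | no u≢c with u ≟ suc c
  ...   | yes u≡1+c = upper u≡1+c
  ...   | no u≢1+c = other u≢c u≢1+c

  c≢1+c : c ≢ suc c
  c≢1+c = <⇒≢ (n<1+n c)

  isPair-lower : isPair c ≡ true
  isPair-lower rewrite ≡ᵇ-refl c = refl

  isPair-upper : isPair (suc c) ≡ true
  isPair-upper rewrite ≡ᵇ-refl (suc c) | ≢⇒≡ᵇ-false (c≢1+c ∘ sym) = refl

  isPair-other : ∀ {u} → u ≢ c → u ≢ suc c → isPair u ≡ false
  isPair-other u≢c u≢1+c rewrite ≢⇒≡ᵇ-false u≢c | ≢⇒≡ᵇ-false u≢1+c = refl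

  isUpper-lower : isUpper c ≡ false
  isUpper-lower = ≢⇒≡ᵇ-false c≢1+c

  isUpper-upper : isUpper (suc c) ≡ true
  isUpper-upper = ≡ᵇ-refl (suc c)

  swapIf : Bool → ℕ → ℕ
  swapIf f u = if f then adjSwap c u else u

  swapIf-outside : ∀ f {u} → isPair u ≡ false → swapIf f u ≡ u
  swapIf-outside false _ = refl
  swapIf-outside true {u} outside with pairView u
  ... | lower refl = ⊥-elim (true≢false (≡.trans (sym isPair-lower) outside))
  ... | upper refl = ⊥-elim (true≢false (≡.trans (sym isPair-upper) outside))
  ... | other u≢c u≢1+c = adjSwap-other c u≢c u≢1+c

  isPair-swapIf : ∀ f u → isPair (swapIf f u) ≡ isPair u
  isPair-swapIf false u = refl
  isPair-swapIf true u with pairView u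
  ... | lower refl rewrite adjSwap-lower c | isPair-lower | isPair-upper = refl
  ... | upper refl rewrite adjSwap-upper c | isPair-lower | isPair-upper = refl
  ... | other u≢c u≢1+c rewrite adjSwap-other c u≢c u≢1+c = refl

  isUpper-swapIf : ∀ f {u} → isPair u ≡ true → isUpper (swapIf f u) ≡ isUpper u xor f
  isUpper-swapIf false {u} _ = sym (xor-identityʳ (isUpper u))
  isUpper-swapIf true {u} inPair with pairView u
  ... | lower refl rewrite adjSwap-lower c | isUpper-lower | isUpper-upper = refl
  ... | upper refl rewrite adjSwap-upper c | isUpper-lower | isUpper-upper = refl
  ... | other u≢c u≢1+c = ⊥-elim (true≢false (≡.trans (sym inPair) (isPair-other u≢c u≢1+c)))

  swapIf-involutive : ∀ f u → swapIf f (swapIf f u) ≡ u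
  swapIf-involutive false u = refl
  swapIf-involutive true u with pairView u
  ... | lower refl rewrite adjSwap-lower c = adjSwap-upper c
  ... | upper refl rewrite adjSwap-upper c = adjSwap-lower c
  ... | other u≢c u≢1+c rewrite adjSwap-other c u≢c u≢1+c = adjSwap-other c u≢c u≢1+c

  swapIf-injective : ∀ f {u v} → swapIf f u ≡ swapIf f v → u ≡ v
  swapIf-injective f {u} {v} e = ≡.trans (sym (swapIf-involutive f u)) (≡.trans (cong (swapIf f) e) (swapIf-involutive f v))

  swapIf-≢ : ∀ {u v} fu fv → u ≢ v → (isPair u ≡ true → isPair v ≡ true → fu ≡ fv) → swapIf fu u ≢ swapIf fv v
  swapIf-≢ {u} {v} fu fv u≢v sameFlip e with isPair u in pu | isPair v in pv
  ... | true | true rewrite sameFlip refl refl = u≢v (swapIf-injective fv e)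
  ... | false | false = u≢v (≡.trans (sym (swapIf-outside fu pu)) (≡.trans e (swapIf-outside fv pv)))
  ... | true | false = true≢false (≡.trans (sym (≡.trans (isPair-swapIf fu u) pu)) (≡.trans (cong isPair e) (≡.trans (isPair-swapIf fv v) pv)))
  ... | false | true = true≢false (≡.trans (sym (≡.trans (isPair-swapIf fv v) pv)) (≡.trans (cong isPair (sym e)) (≡.trans (isPair-swapIf fu u) pu)))

  pair-isUpper-≢ : ∀ {u v} → isPair u ≡ true → isPair v ≡ true → u ≢ v → isUpper u ≡ not (isUpper v)
  pair-isUpper-≢ {u} {v} pu pv u≢v with pairView u | pairView v
  ... | lower refl | lower refl = ⊥-elim (u≢v refl)
  ... | lower refl | upper refl rewrite isUpper-lower | isUpper-upper = refl
  ... | upper refl | lower refl rewrite isUpper-lower | isUpper-upper = refl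
  ... | upper refl | upper refl = ⊥-elim (u≢v refl)
  ... | other u≢c u≢1+c | _ = ⊥-elim (true≢false (≡.trans (sym pu) (isPair-other u≢c u≢1+c)))
  ... | _ | other v≢c v≢1+c = ⊥-elim (true≢false (≡.trans (sym pv) (isPair-other v≢c v≢1+c)))

  no-three-distinct : ∀ {u v w} → isPair u ≡ true → isPair v ≡ true → isPair w ≡ true → u ≢ v → v ≢ w → u ≢ w → ⊥
  no-three-distinct {u} {v} {w} pu pv pw u≢v v≢w u≢w with pairView u | pairView v | pairView w
  ... | other x y | _ | _ = true≢false (≡.trans (sym pu) (isPair-other x y))
  ... | _ | other x y | _ = true≢false (≡.trans (sym pv) (isPair-other x y))
  ... | _ | _ | other x y = true≢false (≡.trans (sym pw) (isPair-other x y))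
  ... | lower refl | lower refl | _ = u≢v refl
  ... | upper refl | upper refl | _ = u≢v refl
  ... | lower refl | upper refl | lower refl = u≢w refl
  ... | lower refl | upper refl | upper refl = v≢w refl
  ... | upper refl | lower refl | lower refl = v≢w refl
  ... | upper refl | lower refl | upper refl = u≢w refl

  other-<-iff : ∀ {v} → v ≢ c → v ≢ suc c → (suc c < v ⇔ c < v) × (v < suc c ⇔ v < c)
  other-<-iff {v} v≢c v≢1+c =
    mk⇔ (<-trans (n<1+n c)) (λ c<v → ≤∧≢⇒< c<v (v≢1+c ∘ sym)) ,
    mk⇔ (λ v<1+c → ≤∧≢⇒< (≤-pred v<1+c) v≢c) (λ v<c → <-trans v<c (n<1+n c))

  pair-<-other : ∀ {w v} → isPair w ≡ true → v ≢ c → v ≢ suc c → does (w <? v) ≡ does (c <? v)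
  pair-<-other {w} {v} pw v≢c v≢1+c with pairView w
  ... | lower refl = refl
  ... | upper refl = does-⇔ (proj₁ (other-<-iff v≢c v≢1+c)) (suc c <? v) (c <? v)
  ... | other x y = ⊥-elim (true≢false (≡.trans (sym pw) (isPair-other x y)))

  other-<-pair : ∀ {w v} → isPair w ≡ true → v ≢ c → v ≢ suc c → does (v <? w) ≡ does (v <? c)
  other-<-pair {w} {v} pw v≢c v≢1+c with pairView w
  ... | lower refl = refl
  ... | upper refl = does-⇔ (proj₂ (other-<-iff v≢c v≢1+c)) (v <? suc c) (v <? c)
  ... | other x y = ⊥-elim (true≢false (≡.trans (sym pw) (isPair-other x y)))

  outside-≢ : ∀ {u} → isPair u ≡ false → u ≢ c × u ≢ suc c
  outside-≢ pu = (λ { refl → true≢false (≡.trans (sym isPair-lower) pu) }) ,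
                 (λ { refl → true≢false (≡.trans (sym isPair-upper) pu) })

  other-<-swapIf : ∀ {u} f v → u ≢ c → u ≢ suc c → does (u <? swapIf f v) ≡ does (u <? v)
  other-<-swapIf {u} f v u≢c u≢1+c with isPair v in pv
  ... | true = ≡.trans (other-<-pair {swapIf f v} (≡.trans (isPair-swapIf f v) pv) u≢c u≢1+c) (sym (other-<-pair {v} pv u≢c u≢1+c))
  ... | false = cong (λ w → does (u <? w)) (swapIf-outside f pv)

  swapIf-<-other : ∀ f u {v} → v ≢ c → v ≢ suc c → does (swapIf f u <? v) ≡ does (u <? v)
  swapIf-<-other f u {v} v≢c v≢1+c with isPair u in pu
  ... | true = ≡.trans (pair-<-other {swapIf f u} (≡.trans (isPair-swapIf f u) pu) v≢c v≢1+c) (sym (pair-<-other {u} pu v≢c v≢1+c))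
  ... | false = cong (λ w → does (w <? v)) (swapIf-outside f pu)

  ascent-swapIf : ∀ {u v} fu fv → u ≢ v → (isPair u ≡ true → isPair v ≡ true → fu ≡ fv) →
    ⟦ does (swapIf fu u <? swapIf fv v) ⟧ + ⟦ (isPair u ∧ not (isUpper u)) ∧ isPair v ⟧ ≡
    ⟦ does (u <? v) ⟧ + ⟦ (isPair u ∧ not (isUpper (swapIf fu u))) ∧ isPair v ⟧
  ascent-swapIf {u} {v} fu fv u≢v sameFlip with isPair u in pu | isPair v in pv
  ... | false | _ = cong (λ b → ⟦ b ⟧ + 0)
    (≡.trans (cong (λ w → does (w <? swapIf fv v)) (swapIf-outside fu {u} pu))
             (other-<-swapIf fv v (proj₁ (outside-≢ {u} pu)) (proj₂ (outside-≢ {u} pu))))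
  ... | true | false = cong₂ _+_
    (cong ⟦_⟧ (≡.trans (cong (λ w → does (swapIf fu u <? w)) (swapIf-outside fv {v} pv))
                       (swapIf-<-other fu u (proj₁ (outside-≢ {v} pv)) (proj₂ (outside-≢ {v} pv)))))
    (cong ⟦_⟧ (≡.trans (∧-zeroʳ (not (isUpper u))) (sym (∧-zeroʳ (not (isUpper (swapIf fu u)))))))
  ... | true | true with sameFlip refl refl | pairView u | pairView v
  ...   | refl | lower refl | lower refl = ⊥-elim (u≢v refl)
  ...   | refl | upper refl | upper refl = ⊥-elim (u≢v refl)
  ...   | refl | other x y | _ = ⊥-elim (true≢false (≡.trans (sym pu) (isPair-other x y)))
  ...   | refl | _ | other x y = ⊥-elim (true≢false (≡.trans (sym pv) (isPair-other x y)))
  ...   | refl | lower refl | upper refl = edge fu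
    where
    edge : ∀ f → ⟦ does (swapIf f c <? swapIf f (suc c)) ⟧ + ⟦ not (isUpper c) ∧ true ⟧ ≡
                 ⟦ does (c <? suc c) ⟧ + ⟦ not (isUpper (swapIf f c)) ∧ true ⟧
    edge false = refl
    edge true rewrite adjSwap-lower c | adjSwap-upper c | isUpper-lower | isUpper-upper
                    | dec-true (c <? suc c) (n<1+n c) | dec-false (suc c <? c) (<-asym (n<1+n c)) = refl
  ...   | refl | upper refl | lower refl = edge fu
    where
    edge : ∀ f → ⟦ does (swapIf f (suc c) <? swapIf f c) ⟧ + ⟦ not (isUpper (suc c)) ∧ true ⟧ ≡
                 ⟦ does (suc c <? c) ⟧ + ⟦ not (isUpper (swapIf f (suc c))) ∧ true ⟧
    edge false = refl
    edge true rewrite adjSwap-lower c | adjSwap-upper c | isUpper-lower | isUpper-upper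
                    | dec-true (c <? suc c) (n<1+n c) | dec-false (suc c <? c) (<-asym (n<1+n c)) = refl

  swapIf-lower : ∀ f → swapIf f c ≡ (if f then suc c else c)
  swapIf-lower false = refl
  swapIf-lower true = adjSwap-lower c

  swapIf-upper : ∀ f → swapIf f (suc c) ≡ (if f then c else suc c)
  swapIf-upper false = refl
  swapIf-upper true = adjSwap-upper c

  swapIf-≡ᵇ-lower : ∀ f y → (swapIf f y ≡ᵇ c) ≡ (isPair y ∧ not (isUpper y xor f))
  swapIf-≡ᵇ-lower f y with pairView y
  ... | lower refl = ≡.trans (cong (_≡ᵇ c) (swapIf-lower f)) (≡.trans (values f) (sym (cong₂ (λ p u → p ∧ not (u xor f)) isPair-lower isUpper-lower)))
    where
    values : ∀ f → ((if f then suc c else c) ≡ᵇ c) ≡ not f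
    values false = ≡ᵇ-refl c
    values true = ≢⇒≡ᵇ-false (c≢1+c ∘ sym)
  ... | upper refl = ≡.trans (cong (_≡ᵇ c) (swapIf-upper f)) (≡.trans (values f) (sym (cong₂ (λ p u → p ∧ not (u xor f)) isPair-upper isUpper-upper)))
    where
    values : ∀ f → ((if f then c else suc c) ≡ᵇ c) ≡ not (not f)
    values false = ≢⇒≡ᵇ-false (c≢1+c ∘ sym)
    values true = ≡ᵇ-refl c
  ... | other y≢c y≢1+c =
    ≡.trans (cong (_≡ᵇ c) (swapIf-outside f (isPair-other y≢c y≢1+c)))
            (≡.trans (≢⇒≡ᵇ-false y≢c) (sym (cong (λ p → p ∧ not (isUpper y xor f)) (isPair-other y≢c y≢1+c))))

  swapIf-≡ᵇ-upper : ∀ f y → (swapIf f y ≡ᵇ suc c) ≡ (isPair y ∧ (isUpper y xor f))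
  swapIf-≡ᵇ-upper f y with pairView y
  ... | lower refl = ≡.trans (cong (_≡ᵇ suc c) (swapIf-lower f)) (≡.trans (values f) (sym (cong₂ (λ p u → p ∧ (u xor f)) isPair-lower isUpper-lower)))
    where
    values : ∀ f → ((if f then suc c else c) ≡ᵇ suc c) ≡ f
    values false = ≢⇒≡ᵇ-false c≢1+c
    values true = ≡ᵇ-refl (suc c)
  ... | upper refl = ≡.trans (cong (_≡ᵇ suc c) (swapIf-upper f)) (≡.trans (values f) (sym (cong₂ (λ p u → p ∧ (u xor f)) isPair-upper isUpper-upper)))
    where
    values : ∀ f → ((if f then c else suc c) ≡ᵇ suc c) ≡ not f
    values false = ≡ᵇ-refl (suc c)
    values true = ≢⇒≡ᵇ-false c≢1+c
  ... | other y≢c y≢1+c =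
    ≡.trans (cong (_≡ᵇ suc c) (swapIf-outside f (isPair-other y≢c y≢1+c)))
            (≡.trans (≢⇒≡ᵇ-false y≢1+c) (sym (cong (λ p → p ∧ (isUpper y xor f)) (isPair-other y≢c y≢1+c))))

  ≡ᵇ-lower : ∀ y → (y ≡ᵇ c) ≡ (isPair y ∧ not (isUpper y))
  ≡ᵇ-lower y = ≡.trans (swapIf-≡ᵇ-lower false y) (cong (λ b → isPair y ∧ not b) (xor-identityʳ (isUpper y)))

  ≡ᵇ-upper : ∀ y → (y ≡ᵇ suc c) ≡ (isPair y ∧ isUpper y)
  ≡ᵇ-upper y = ≡.trans (swapIf-≡ᵇ-upper false y) (cong (isPair y ∧_) (xor-identityʳ (isUpper y)))

  swapIf-≡ᵇ-other : ∀ f y {c′} → c′ ≢ c → c′ ≢ suc c → (swapIf f y ≡ᵇ c′) ≡ (y ≡ᵇ c′)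
  swapIf-≡ᵇ-other f y {c′} c′≢c c′≢1+c with pairView y
  ... | lower refl = ≡.trans (cong (_≡ᵇ c′) (swapIf-lower f)) (≡.trans (values f) (sym (≢⇒≡ᵇ-false (c′≢c ∘ sym))))
    where
    values : ∀ f → ((if f then suc c else c) ≡ᵇ c′) ≡ false
    values false = ≢⇒≡ᵇ-false (c′≢c ∘ sym)
    values true = ≢⇒≡ᵇ-false (c′≢1+c ∘ sym)
  ... | upper refl = ≡.trans (cong (_≡ᵇ c′) (swapIf-upper f)) (≡.trans (values f) (sym (≢⇒≡ᵇ-false (c′≢1+c ∘ sym))))
    where
    values : ∀ f → ((if f then c else suc c) ≡ᵇ c′) ≡ false
    values false = ≢⇒≡ᵇ-false (c′≢1+c ∘ sym)
    values true = ≢⇒≡ᵇ-false (c′≢c ∘ sym)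
  ... | other y≢c y≢1+c = cong (_≡ᵇ c′) (swapIf-outside f (isPair-other y≢c y≢1+c))

-- The circular unit arc digraph

[m%n+k]%n≡[m+k]%n : ∀ m k n .{{_ : NonZero n}} → (m % n + k) % n ≡ (m + k) % n
[m%n+k]%n≡[m+k]%n m k n = begin
  (m % n + k) % n           ≡⟨ %-distribˡ-+ (m % n) k n ⟩
  (m % n % n + k % n) % n   ≡⟨ cong (λ t → (t + k % n) % n) (m%n%n≡m%n m n) ⟩
  (m % n + k % n) % n       ≡⟨ %-distribˡ-+ m k n ⟨
  (m + k) % n               ∎
  where open ≡-Reasoning

module CircularGraph (m : ℕ) (a : Fin (suc m) → ℕ) (cas : CircularAreaSeq a) where

  n : ℕ
  n = suc m

  _~_ : ℕ → ℕ → Set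
  x ~ y = x % n ≡ y % n

  ~-+ : ∀ x y k → x ~ y → (x + k) ~ (y + k)
  ~-+ x y k x~y = begin
    (x + k) % n       ≡⟨ [m%n+k]%n≡[m+k]%n x k n ⟨
    (x % n + k) % n   ≡⟨ cong (λ t → (t + k) % n) x~y ⟩
    (y % n + k) % n   ≡⟨ [m%n+k]%n≡[m+k]%n y k n ⟩
    (y + k) % n       ∎
    where open ≡-Reasoning

  +n~ : ∀ x → (x + n) ~ x
  +n~ x = [m+n]%n≡m%n x n

  vertex : ℕ → Fin n
  vertex x = fromℕ< (m%n<n x n)

  vertex-cong : ∀ x y → x ~ y → vertex x ≡ vertex y
  vertex-cong x y x~y = fromℕ<-cong _ _ x~y (m%n<n x n) (m%n<n y n)

  vertex-toℕ : ∀ i → vertex (toℕ i) ≡ i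
  vertex-toℕ i = ≡.trans (fromℕ<-cong _ _ (m<n⇒m%n≡m (toℕ<n i)) (m%n<n (toℕ i) n) (toℕ<n i)) (fromℕ<-toℕ i (toℕ<n i))

  toℕ-vertex : ∀ x → toℕ (vertex x) ≡ x % n
  toℕ-vertex x = toℕ-fromℕ< (m%n<n x n)

  toℕ-shift-vertex : ∀ x d → toℕ (shift (vertex x) d) ≡ (x + d) % n
  toℕ-shift-vertex x d = ≡.trans (toℕ-fromℕ< _) (≡.trans (cong (λ t → (t + d) % n) (toℕ-vertex x)) ([m%n+k]%n≡[m+k]%n x d n))

  colourAt : Coloring m → ℕ → ℕ
  colourAt F x = lookup F (vertex x)

  reach : ℕ → ℕ
  reach x = a (vertex x)

  reach-step : ∀ x → reach x ≤ reach (suc x) + 1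
  reach-step x = subst (λ v → reach x ≤ a v + 1) same (proj₂ cas (vertex x))
    where
    same : shift (vertex x) 1 ≡ vertex (suc x)
    same = ≡.trans (sym (vertex-toℕ _)) (vertex-cong (toℕ (shift (vertex x) 1)) (suc x) (≡.trans (m<n⇒m%n≡m (toℕ<n (shift (vertex x) 1)))
             (≡.trans (toℕ-shift-vertex x 1) (cong (_% n) (+-comm x 1)))))

  reach-descent : ∀ x e → reach x ≤ reach (x + e) + e
  reach-descent x zero = subst (reach x ≤_) (sym (≡.trans (+-identityʳ _) (cong reach (+-identityʳ x)))) ≤-refl
  reach-descent x (suc e) = ≤-trans (reach-descent x e)
    (subst (reach (x + e) + e ≤_) (≡.trans (+-assoc (reach (suc (x + e))) 1 e) (cong (λ y → reach y + suc e) (sym (+-suc x e))))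
      (+-monoˡ-≤ e (reach-step (x + e))))

  nested-edge : ∀ x e t → e + t ≤ reach x → t ≤ reach (x + e)
  nested-edge x e t e+t≤ = +-cancelˡ-≤ e t (reach (x + e))
    (≤-trans e+t≤ (subst (reach x ≤_) (+-comm (reach (x + e)) e) (reach-descent x e)))

  proper-edge : ∀ F → Proper a F → ∀ x t → 1 ≤ t → t ≤ reach x → colourAt F x ≢ colourAt F (x + t)
  proper-edge F proper x t 1≤t t≤ e = proper (vertex x) t 1≤t t≤ (≡.trans e (cong (lookup F) same))
    where
    same : vertex (x + t) ≡ shift (vertex x) t
    same = ≡.trans (vertex-cong (x + t) (toℕ (shift (vertex x) t)) (sym (≡.trans (m<n⇒m%n≡m (toℕ<n (shift (vertex x) t))) (toℕ-shift-vertex x t)))) (vertex-toℕ _)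

  count-colour : ∀ G c′ → length (filter (λ i → lookup G i ≟ c′) (allFin n)) ≡ ∑[ x < n ] ⟦ colourAt G x ≡ᵇ c′ ⟧
  count-colour G c′ = begin
    length (filter (λ i → lookup G i ≟ c′) (allFin n))  ≡⟨ length-filter-tabulate (λ i → lookup G i ≟ c′) n id ⟩
    ∑Fin n (λ i → ⟦ lookup G i ≡ᵇ c′ ⟧)                 ≡⟨ ∑Fin-cong n (λ i → cong (λ k → ⟦ lookup G k ≡ᵇ c′ ⟧) (sym (vertex-toℕ i))) ⟩
    ∑Fin n (λ i → ⟦ colourAt G (toℕ i) ≡ᵇ c′ ⟧)         ≡⟨ ∑Fin-toℕ n (λ x → ⟦ colourAt G x ≡ᵇ c′ ⟧) ⟩
    ∑[ x < n ] ⟦ colourAt G x ≡ᵇ c′ ⟧                   ∎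
    where open ≡-Reasoning

  ascentsFrom : Coloring m → ℕ → ℕ
  ascentsFrom G x = ∑[ t < reach x ] ⟦ does (colourAt G x <? colourAt G (x + suc t)) ⟧

  asc≡∑ascentsFrom : ∀ G → asc a G ≡ ∑< n (ascentsFrom G)
  asc≡∑ascentsFrom G = ≡.trans (sum-map-tabulate n ascentsAt id)
                         (≡.trans (∑Fin-cong n per-vertex) (∑Fin-toℕ n (ascentsFrom G)))
    where
    ascentsAt : Fin n → ℕ
    ascentsAt i = length (filter (λ d → lookup G i <? lookup G (shift i d)) (applyUpTo suc (a i)))
    per-vertex : ∀ i → ascentsAt i ≡ ascentsFrom G (toℕ i)
    per-vertex i = ≡.trans (length-filter-applyUpTo (λ d → lookup G i <? lookup G (shift i d)) suc (a i))
      (cong (λ k → ∑[ t < a k ] ⟦ does (lookup G k <? colourAt G (toℕ i + suc t)) ⟧) (sym (vertex-toℕ i)))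

  ∑-rotate~ : (g : ℕ → ℕ) → (∀ x y → x ~ y → g x ≡ g y) → ∀ r → ∑< n g ≡ ∑[ j < n ] g (r + j)
  ∑-rotate~ g g-cong r = sym (∑-rotate n g (λ y → g-cong (y + n) y (+n~ y)) r)

  module PairRuns (c : ℕ) where
    open AdjacentColours c public

    pairAt : Coloring m → ℕ → Bool
    pairAt F x = isPair (colourAt F x)

    pair-edge-has-no-pair-inside : ∀ F → Proper a F → ∀ x t → pairAt F x ≡ true → 1 ≤ t → t ≤ reach x →
      pairAt F (x + t) ≡ true → ∀ e → 0 < e → e < t → pairAt F (x + e) ≡ false
    pair-edge-has-no-pair-inside F proper x t px 1≤t t≤ pxt e 0<e e<t with pairAt F (x + e) in pxe
    ... | false = refl
    ... | true = ⊥-elim (no-three-distinct {colourAt F x} {colourAt F (x + e)} {colourAt F (x + t)} px pxe pxt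
                  (proper-edge F proper x e 0<e (≤-trans (<⇒≤ e<t) t≤))
                  (λ eq → proper-edge F proper (x + e) (t ∸ e) (m<n⇒0<n∸m e<t)
                            (nested-edge x e (t ∸ e) (subst (_≤ reach x) (sym (m+[n∸m]≡n (<⇒≤ e<t))) t≤))
                            (≡.trans eq (cong (colourAt F) (sym x+e+[t∸e]))))
                  (proper-edge F proper x t 1≤t t≤))
      where
      x+e+[t∸e] : x + e + (t ∸ e) ≡ x + t
      x+e+[t∸e] = ≡.trans (+-assoc x e (t ∸ e)) (cong (x +_) (m+[n∸m]≡n (<⇒≤ e<t)))

    startAfter : Maybe ℕ → ℕ
    startAfter (just u) = suc u
    startAfter nothing = 0

    module Decomposition (marked : ℕ → Bool) where

      linked : ℕ → Bool
      linked x = marked x ∧ any< (reach x) (λ t → marked (x + suc t))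

      unlinked : ℕ → Bool
      unlinked x = marked x ∧ not (linked x)

      -- Positions are counted from just after the first run end (from 0 if there is none),
      -- so that no run straddles position n.
      opaque
        start : ℕ
        start = startAfter (first< n unlinked)

        start-def : start ≡ startAfter (first< n unlinked)
        start-def = refl

      open Runs n (λ j → marked (start + j)) (λ j → linked (start + j)) public

      position : ℕ → ℕ
      position x = (x + (n ∸ start)) % n

      flip : ℕ → Bool
      flip x = flipAt (position x)

    flip-cong : ∀ {marked marked′} → marked ≗ marked′ → Decomposition.flip marked ≗ Decomposition.flip marked′
    flip-cong {marked} {marked′} same x =
      ≡.trans (cong (λ s → D.flipAt ((x + (n ∸ s)) % n)) same-start)
              (flipAt-cong n (λ j → ≡.trans (cong (λ s → marked (s + j)) same-start) (same _))
                             (λ j → ≡.trans (cong (λ s → D.linked (s + j)) same-start) (same-linked _)) (D′.position x))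
      where
      module D = Decomposition marked
      module D′ = Decomposition marked′
      same-linked : D.linked ≗ D′.linked
      same-linked y = cong₂ _∧_ (same y) (any<-cong (reach y) (λ t → same (y + suc t)))
      same-start : D.start ≡ D′.start
      same-start = ≡.trans D.start-def (≡.trans (cong startAfter (first<-cong n (λ y → cong₂ (λ p l → p ∧ not l) (same y) (same-linked y)))) (sym D′.start-def))

    module OfColouring (F : Coloring m) where

      marked : ℕ → Bool
      marked = pairAt F

      open Decomposition marked public

      colour : ℕ → Bool
      colour j = isUpper (colourAt F (start + j))

      open Coloured colour public

      colourAt-cong : ∀ x y → x ~ y → colourAt F x ≡ colourAt F y
      colourAt-cong x y x~y = cong (lookup F) (vertex-cong x y x~y)

      marked-cong : ∀ x y → x ~ y → marked x ≡ marked y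
      marked-cong x y x~y = cong isPair (colourAt-cong x y x~y)

      linked-cong : ∀ x y → x ~ y → linked x ≡ linked y
      linked-cong x y x~y = cong₂ _∧_ (marked-cong x y x~y)
        (≡.trans (any<-cong (reach x) (λ t → marked-cong (x + suc t) (y + suc t) (~-+ x y (suc t) x~y)))
                 (cong (λ r → any< r (λ t → marked (y + suc t))) (cong a (vertex-cong x y x~y))))

      unlinked-cong : ∀ x y → x ~ y → unlinked x ≡ unlinked y
      unlinked-cong x y x~y = cong₂ (λ p l → p ∧ not l) (marked-cong x y x~y) (linked-cong x y x~y)

      StartsAfterRunEnd : Set
      StartsAfterRunEnd = Σ ℕ λ u → u < n × start ≡ suc u × unlinked u ≡ true

      NoRunEnd : Set
      NoRunEnd = ∀ x → x < n → unlinked x ≡ false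

      start-cases : StartsAfterRunEnd ⊎ NoRunEnd
      start-cases with first< n unlinked in e
      ... | just u = inj₁ (u , proj₁ (first<-just n unlinked e) , ≡.trans start-def (cong startAfter e) , proj₂ (first<-just n unlinked e))
      ... | nothing = inj₂ (first<-nothing n unlinked e)

      start≤n : start ≤ n
      start≤n rewrite start-def with first< n unlinked in e
      ... | just u = proj₁ (first<-just n unlinked e)
      ... | nothing = z≤n

      start+j+[n∸start] : ∀ j → start + j + (n ∸ start) ≡ j + n
      start+j+[n∸start] j = begin
        start + j + (n ∸ start)   ≡⟨ +-assoc start j _ ⟩
        start + (j + (n ∸ start)) ≡⟨ cong (start +_) (+-comm j _) ⟩
        start + ((n ∸ start) + j) ≡⟨ +-assoc start _ j ⟨
        start + (n ∸ start) + j   ≡⟨ cong (_+ j) (m+[n∸m]≡n start≤n) ⟩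
        n + j                     ≡⟨ +-comm n j ⟩
        j + n                     ∎
        where open ≡-Reasoning

      position-start : ∀ j → j < n → position (start + j) ≡ j
      position-start j j<n = ≡.trans (cong (_% n) (start+j+[n∸start] j)) (≡.trans (+n~ j) (m<n⇒m%n≡m j<n))

      start+position : ∀ x → (start + position x) ~ x
      start+position x = begin
        (start + (x + (n ∸ start)) % n) % n  ≡⟨ cong (_% n) (+-comm start _) ⟩
        ((x + (n ∸ start)) % n + start) % n  ≡⟨ [m%n+k]%n≡[m+k]%n (x + (n ∸ start)) start n ⟩
        (x + (n ∸ start) + start) % n        ≡⟨ cong (_% n) (≡.trans (+-assoc x _ start) (cong (x +_) (m∸n+n≡m start≤n))) ⟩
        (x + n) % n                          ≡⟨ +n~ x ⟩
        x % n                                ∎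
        where open ≡-Reasoning

      position<n : ∀ x → position x < n
      position<n x = m%n<n (x + (n ∸ start)) n

      flip-start : ∀ j → j < n → flip (start + j) ≡ flipAt j
      flip-start j j<n = cong flipAt (position-start j j<n)

      position-cong : ∀ x y → x ~ y → position x ≡ position y
      position-cong x y = ~-+ x y (n ∸ start)

      flip-cong~ : ∀ x y → x ~ y → flip x ≡ flip y
      flip-cong~ x y x~y = cong flipAt (position-cong x y x~y)

      last-is-runEnd : StartsAfterRunEnd → runEnd m ≡ true
      last-is-runEnd (u , _ , start≡ , end) =
        ≡.trans (unlinked-cong (start + m) u (≡.trans (cong (λ s → (s + m) % n) start≡) (≡.trans (cong (_% n) (sym (+-suc u m))) (+n~ u)))) end

      no-runEnd : NoRunEnd → ∀ j → j < n → runEnd j ≡ false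
      no-runEnd none j _ = ≡.trans (unlinked-cong (start + j) ((start + j) % n) (sym (m%n%n≡m%n (start + j) n)))
                                   (none _ (m%n<n (start + j) n))

      linked-intro : ∀ x t → 1 ≤ t → t ≤ reach x → marked x ≡ true → marked (x + t) ≡ true → linked x ≡ true
      linked-intro x (suc t) _ t≤ mx mxt rewrite mx = any<-intro (reach x) (λ s → marked (x + suc s)) t≤ mxt

      linked-witness : ∀ x → linked x ≡ true → Σ ℕ λ t → t < reach x × marked (x + suc t) ≡ true
      linked-witness x e with marked x
      ... | true = any<-witness (reach x) _ e

      module WhenProper (proper : Proper a F) where

        start-edge : ∀ {i t} → t ≤ reach (start + i) → 0 < t → colourAt F (start + i) ≢ colourAt F (start + i + t)
        start-edge {i} {t} t≤ 0<t = proper-edge F proper (start + i) t 0<t t≤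

        alternating : Alternating
        alternating j j<n mj inRun-j with inRun-witness j inRun-j
        ... | i , i<j , mi , li , last , gap with linked-witness (start + i) li
        ...   | t , t<reach , marked-target with j ≤? i + suc t
        ...     | no j≰ = ⊥-elim (true≢false (≡.trans (sym marked-i+t) (gap (i + suc t) (m<m+n i (s≤s z≤n)) (≰⇒> j≰))))
          where
          marked-i+t : marked (start + (i + suc t)) ≡ true
          marked-i+t = ≡.trans (cong marked (sym (+-assoc start i (suc t)))) marked-target
        ...     | yes j≤ = ≡.trans (pair-isUpper-≢ mj mi (colours-differ ∘ sym)) (cong not (sym last))
          where
          colours-differ : colourAt F (start + i) ≢ colourAt F (start + j)
          colours-differ e = start-edge {i} {j ∸ i}
            (≤-trans (∸-monoˡ-≤ i j≤) (≤-trans (≤-reflexive (m+n∸m≡n i (suc t))) t<reach)) (m<n⇒0<n∸m i<j)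
            (≡.trans e (cong (colourAt F) (sym (≡.trans (+-assoc start i _) (cong (start +_) (m+[n∸m]≡n (<⇒≤ i<j)))))))

        module WithoutRunEnd (none : NoRunEnd) where
          open WithoutRunEnds (no-runEnd none) alternating

          -- The edge leaving the last marked vertex wraps around past position n, and it can only
          -- land on the first marked vertex.
          wraps : inRun n ≡ true → lastColour n ≡ not (runStartColour n)
          wraps inRun-n with inRun-witness n inRun-n | runStart-witness n ≤-refl inRun-n
          ... | il , il<n , m-il , l-il , last , gap-after | jf , jf<n , m-jf , first , gap-before
            with linked-witness (start + il) l-il
          ...   | t , t<reach , marked-target with n ≤? il + suc t
          ...     | no n≰ = ⊥-elim (true≢false (≡.trans (sym (≡.trans (cong marked (sym (+-assoc start il (suc t)))) marked-target))
                                             (gap-after (il + suc t) (m<m+n il (s≤s z≤n)) (≰⇒> n≰))))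
          ...     | yes n≤ = target-is-first
            where
            q = il + suc t ∸ n
            q+n : q + n ≡ il + suc t
            q+n = m∸n+n≡m n≤
            target~ : (start + il + suc t) ~ (start + q)
            target~ = ≡.trans (cong (_% n) (≡.trans (+-assoc start il (suc t)) (cong (start +_) (sym q+n))))
                              (≡.trans (cong (_% n) (sym (+-assoc start q n))) (+n~ (start + q)))
            m-q : marked (start + q) ≡ true
            m-q = ≡.trans (sym (marked-cong (start + il + suc t) (start + q) target~)) marked-target
            target-is-first : lastColour n ≡ not (runStartColour n)
            target-is-first with <-cmp q jf
            ... | tri< q<jf _ _ = ⊥-elim (true≢false (≡.trans (sym m-q) (gap-before q q<jf)))
            ... | tri≈ _ refl _ = ≡.trans last (≡.trans (pair-isUpper-≢ m-il m-jf colours-differ) (cong not (sym first)))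
              where
              colours-differ : colourAt F (start + il) ≢ colourAt F (start + q)
              colours-differ e = start-edge {il} {suc t} t<reach (s≤s z≤n)
                                   (≡.trans e (colourAt-cong (start + q) (start + il + suc t) (sym target~)))
            ... | tri> _ _ jf<q = ⊥-elim (true≢false (≡.trans (sym m-jf′) inside))
              where
              e = n + jf ∸ il
              il+e : il + e ≡ n + jf
              il+e = m+[n∸m]≡n (<⇒≤ (<-≤-trans il<n (m≤m+n n jf)))
              e<1+t : e < suc t
              e<1+t = +-cancelˡ-< il e (suc t)
                (subst (_< il + suc t) (sym il+e) (subst (n + jf <_) q+n (subst (_< q + n) (+-comm jf n) (+-monoˡ-< n jf<q))))
              inside : marked (start + il + e) ≡ false
              inside = pair-edge-has-no-pair-inside F proper (start + il) (suc t) m-il (s≤s z≤n) t<reach marked-target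
                         e (m<n⇒0<n∸m (<-≤-trans il<n (m≤m+n n jf))) e<1+t
              m-jf′ : marked (start + il + e) ≡ true
              m-jf′ = ≡.trans (marked-cong (start + il + e) (start + jf)
                        (≡.trans (cong (_% n) (≡.trans (+-assoc start il e) (cong (start +_) (≡.trans il+e (+-comm n jf)))))
                                 (≡.trans (cong (_% n) (sym (+-assoc start jf n))) (+n~ (start + jf))))) m-jf

        closed : parityBefore n ≡ false
        closed with start-cases
        ... | inj₁ after rewrite last-is-runEnd after = refl
        ... | inj₂ none = WithoutRunEnds.parityBefore-closes (no-runEnd none) alternating (WithoutRunEnd.wraps none)

        flip-edge : ∀ x t → 1 ≤ t → t ≤ reach x → marked x ≡ true → marked (x + t) ≡ true → flip x ≡ flip (x + t)
        flip-edge x t 1≤t t≤ mx mxt = same-flip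
          where
          j = position x
          at-j : (start + j) ~ x
          at-j = start+position x
          m-j : marked (start + j) ≡ true
          m-j = ≡.trans (marked-cong (start + j) x at-j) mx
          l-j : linked (start + j) ≡ true
          l-j = ≡.trans (linked-cong (start + j) x at-j) (linked-intro x t 1≤t t≤ mx mxt)
          gap : ∀ s → j < s → s < j + t → marked (start + s) ≡ false
          gap s j<s s<j+t = ≡.trans (marked-cong (start + s) (x + (s ∸ j)) s~)
            (pair-edge-has-no-pair-inside F proper x t mx 1≤t t≤ mxt (s ∸ j) (m<n⇒0<n∸m j<s)
              (+-cancelˡ-< j (s ∸ j) t (subst (_< j + t) (sym (m+[n∸m]≡n (<⇒≤ j<s))) s<j+t)))
            where
            s~ : (start + s) ~ (x + (s ∸ j))
            s~ = ≡.trans (cong (λ z → (start + z) % n) (sym (m+[n∸m]≡n (<⇒≤ j<s))))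
                   (≡.trans (cong (_% n) (sym (+-assoc start j (s ∸ j)))) (~-+ (start + j) x (s ∸ j) at-j))
          same-flip : flip x ≡ flip (x + t)
          same-flip with j + t <? n
          ... | yes j+t<n = sym (≡.trans (cong flipAt (≡.trans (position-cong (x + t) (start + (j + t)) x+t~) (position-start (j + t) j+t<n)))
                                         (flipAt-across-gap j (j + t) m-j l-j (m<m+n j 1≤t) j+t<n gap))
            where
            x+t~ : (x + t) ~ (start + (j + t))
            x+t~ = sym (≡.trans (cong (_% n) (sym (+-assoc start j t))) (~-+ (start + j) x t at-j))
          ... | no j+t≮n with start-cases
          ...   | inj₂ none = ≡.trans (flipAt-constant (no-runEnd none) j (<⇒≤ (position<n x)))
                                      (sym (flipAt-constant (no-runEnd none) (position (x + t)) (<⇒≤ (position<n (x + t)))))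
          ...   | inj₁ after with m≤n⇒m<n∨m≡n (≤-pred (position<n x))
          ...     | inj₂ j≡m = ⊥-elim (true≢false (≡.trans (sym l-m) (not-linked (last-is-runEnd after))))
            where
            l-m : linked (start + m) ≡ true
            l-m = ≡.trans (cong (λ i → linked (start + i)) (sym j≡m)) l-j
            not-linked : ∀ {b} → marked (start + m) ∧ not b ≡ true → b ≡ false
            not-linked {false} _ = refl
            not-linked {true} e with marked (start + m)
            not-linked {true} () | true
            not-linked {true} () | false
          ...     | inj₁ j<m = ⊥-elim (true≢false (≡.trans (sym (∧-true-left (last-is-runEnd after))) (gap m j<m (≮⇒≥ j+t≮n))))
            where
            ∧-true-left : ∀ {p q} → p ∧ q ≡ true → p ≡ true
            ∧-true-left {true} _ = refl

    newColour : Coloring m → ℕ → ℕ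
    newColour F x = swapIf (OfColouring.flip F x) (colourAt F x)

    recolour : Coloring m → Coloring m
    recolour F = tabulate (newColour F ∘ toℕ)

    module Recolouring (F : Coloring m) where
      open OfColouring F

      newColour-cong : ∀ x y → x ~ y → newColour F x ≡ newColour F y
      newColour-cong x y x~y = cong₂ swapIf (flip-cong~ x y x~y) (colourAt-cong x y x~y)

      colourAt-recolour : ∀ y → colourAt (recolour F) y ≡ newColour F y
      colourAt-recolour y = ≡.trans (lookup∘tabulate (newColour F ∘ toℕ) (vertex y))
        (≡.trans (cong (newColour F) (toℕ-vertex y)) (newColour-cong (y % n) y (m%n%n≡m%n y n)))

      marked-recolour : pairAt (recolour F) ≗ marked
      marked-recolour y = ≡.trans (cong isPair (colourAt-recolour y)) (isPair-swapIf (flip y) (colourAt F y))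

      recolour-involutive : recolour (recolour F) ≡ F
      recolour-involutive = ≡.trans (tabulate-cong twice) (tabulate∘lookup F)
        where
        twice : ∀ i → newColour (recolour F) (toℕ i) ≡ lookup F i
        twice i = ≡.trans (cong₂ swapIf (flip-cong marked-recolour (toℕ i)) (colourAt-recolour (toℕ i)))
                    (≡.trans (swapIf-involutive (flip (toℕ i)) (colourAt F (toℕ i))) (cong (lookup F) (vertex-toℕ i)))

      module _ (proper : Proper a F) where
        open WhenProper proper
        open Balanced alternating closed

        recolour-proper : Proper a (recolour F)
        recolour-proper i d 1≤d d≤ e =
          swapIf-≢ (flip x) (flip (x + d)) (proper-edge F proper x d 1≤d d≤′) (flip-edge x d 1≤d d≤′) e′
          where
          x = toℕ i
          d≤′ : d ≤ reach x
          d≤′ = subst (d ≤_) (cong a (sym (vertex-toℕ i))) d≤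
          e′ : newColour F x ≡ newColour F (x + d)
          e′ = ≡.trans (sym (lookup∘tabulate (newColour F ∘ toℕ) i)) (≡.trans e (colourAt-recolour (x + d)))

        newColour-start : ∀ j → j < n → newColour F (start + j) ≡ swapIf (flipAt j) (colourAt F (start + j))
        newColour-start j j<n = cong (λ f → swapIf f (colourAt F (start + j))) (flip-start j j<n)

        recolour-content : ∀ α → HasContent F α → HasContent (recolour F) (α ∘ adjSwap c)
        recolour-content α content c′ = begin
          length (filter (λ i → lookup (recolour F) i ≟ c′) (allFin n)) ≡⟨ count-colour (recolour F) c′ ⟩
          ∑[ x < n ] ⟦ colourAt (recolour F) x ≡ᵇ c′ ⟧
            ≡⟨ ∑-cong n (λ x _ → cong (λ v → ⟦ v ≡ᵇ c′ ⟧) (colourAt-recolour x)) ⟩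
          ∑[ x < n ] ⟦ newColour F x ≡ᵇ c′ ⟧                         ≡⟨ by-colour (pairView c′) ⟩
          α (adjSwap c c′)                                            ∎
          where
          open ≡-Reasoning
          old new : ℕ → ℕ → ℕ
          old c″ x = ⟦ colourAt F x ≡ᵇ c″ ⟧
          new c″ x = ⟦ newColour F x ≡ᵇ c″ ⟧
          old-total : ∀ c″ → ∑< n (old c″) ≡ α c″
          old-total c″ = ≡.trans (sym (count-colour F c″)) (content c″)
          rotate-old : ∀ c″ → ∑< n (old c″) ≡ ∑[ j < n ] old c″ (start + j)
          rotate-old c″ = ∑-rotate~ (old c″) (λ x y x~y → cong (λ v → ⟦ v ≡ᵇ c″ ⟧) (colourAt-cong x y x~y)) start
          rotate-new : ∀ c″ → ∑< n (new c″) ≡ ∑[ j < n ] new c″ (start + j)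
          rotate-new c″ = ∑-rotate~ (new c″) (λ x y x~y → cong (λ v → ⟦ v ≡ᵇ c″ ⟧) (newColour-cong x y x~y)) start
          M = λ j → marked (start + j)
          by-colour : PairView c′ → ∑< n (new c′) ≡ α (adjSwap c c′)
          by-colour (lower refl) = begin
            ∑< n (new c)                                    ≡⟨ rotate-new c ⟩
            ∑[ j < n ] new c (start + j)
              ≡⟨ ∑-cong n (λ j j<n → cong ⟦_⟧ (≡.trans (cong (_≡ᵇ c) (newColour-start j j<n)) (swapIf-≡ᵇ-lower (flipAt j) (colourAt F (start + j))))) ⟩
            ∑[ j < n ] ⟦ M j ∧ not (colour j xor flipAt j) ⟧ ≡⟨ flip-balance ⟩
            ∑[ j < n ] ⟦ M j ∧ colour j ⟧                    ≡⟨ ∑-cong n (λ j _ → cong ⟦_⟧ (sym (≡ᵇ-upper (colourAt F (start + j))))) ⟩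
            ∑[ j < n ] old (suc c) (start + j)              ≡⟨ rotate-old (suc c) ⟨
            ∑< n (old (suc c))                              ≡⟨ old-total (suc c) ⟩
            α (suc c)                                       ≡⟨ cong α (adjSwap-lower c) ⟨
            α (adjSwap c c)                                 ∎
          by-colour (upper refl) = begin
            ∑< n (new (suc c))                              ≡⟨ rotate-new (suc c) ⟩
            ∑[ j < n ] new (suc c) (start + j)
              ≡⟨ ∑-cong n (λ j j<n → cong ⟦_⟧ (≡.trans (cong (_≡ᵇ suc c) (newColour-start j j<n)) (swapIf-≡ᵇ-upper (flipAt j) (colourAt F (start + j))))) ⟩
            ∑[ j < n ] ⟦ M j ∧ (colour j xor flipAt j) ⟧     ≡⟨ flipped-upper ⟩
            ∑[ j < n ] ⟦ M j ∧ not (colour j) ⟧              ≡⟨ ∑-cong n (λ j _ → cong ⟦_⟧ (sym (≡ᵇ-lower (colourAt F (start + j))))) ⟩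
            ∑[ j < n ] old c (start + j)                    ≡⟨ rotate-old c ⟨
            ∑< n (old c)                                    ≡⟨ old-total c ⟩
            α c                                             ≡⟨ cong α (adjSwap-upper c) ⟨
            α (adjSwap c (suc c))                           ∎
            where
            split : ∀ (b : ℕ → Bool) → ∑[ j < n ] ⟦ M j ∧ b j ⟧ + ∑[ j < n ] ⟦ M j ∧ not (b j) ⟧ ≡ ∑[ j < n ] ⟦ M j ⟧
            split b = ≡.trans (sym (∑-distrib-+ n (λ j → ⟦ M j ∧ b j ⟧) (λ j → ⟦ M j ∧ not (b j) ⟧))) (∑-cong n (λ j _ → ⟦∧⟧+⟦∧not⟧ (M j) (b j)))
              where
              ⟦∧⟧+⟦∧not⟧ : ∀ h x → ⟦ h ∧ x ⟧ + ⟦ h ∧ not x ⟧ ≡ ⟦ h ⟧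
              ⟦∧⟧+⟦∧not⟧ false x = refl
              ⟦∧⟧+⟦∧not⟧ true true = refl
              ⟦∧⟧+⟦∧not⟧ true false = refl
            flipped-upper : ∑[ j < n ] ⟦ M j ∧ (colour j xor flipAt j) ⟧ ≡ ∑[ j < n ] ⟦ M j ∧ not (colour j) ⟧
            flipped-upper = +-cancelʳ-≡ (∑[ j < n ] ⟦ M j ∧ colour j ⟧) _ _ (begin
              ∑[ j < n ] ⟦ M j ∧ (colour j xor flipAt j) ⟧ + ∑[ j < n ] ⟦ M j ∧ colour j ⟧
                ≡⟨ cong (∑[ j < n ] ⟦ M j ∧ (colour j xor flipAt j) ⟧ +_) flip-balance ⟨
              ∑[ j < n ] ⟦ M j ∧ (colour j xor flipAt j) ⟧ + ∑[ j < n ] ⟦ M j ∧ not (colour j xor flipAt j) ⟧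
                ≡⟨ split (λ j → colour j xor flipAt j) ⟩
              ∑[ j < n ] ⟦ M j ⟧
                ≡⟨ split (λ j → not (colour j)) ⟨
              ∑[ j < n ] ⟦ M j ∧ not (colour j) ⟧ + ∑[ j < n ] ⟦ M j ∧ not (not (colour j)) ⟧
                ≡⟨ cong (∑[ j < n ] ⟦ M j ∧ not (colour j) ⟧ +_) (∑-cong n (λ j _ → cong (λ b → ⟦ M j ∧ b ⟧) (not-involutive (colour j)))) ⟩
              ∑[ j < n ] ⟦ M j ∧ not (colour j) ⟧ + ∑[ j < n ] ⟦ M j ∧ colour j ⟧ ∎)
          by-colour (other c′≢c c′≢1+c) = begin
            ∑< n (new c′)  ≡⟨ ∑-cong n (λ x _ → cong ⟦_⟧ (swapIf-≡ᵇ-other (flip x) (colourAt F x) c′≢c c′≢1+c)) ⟩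
            ∑< n (old c′)  ≡⟨ old-total c′ ⟩
            α c′           ≡⟨ cong α (adjSwap-other c c′≢c c′≢1+c) ⟨
            α (adjSwap c c′) ∎

        linked∧-as-sum : ∀ x b → ⟦ linked x ∧ b ⟧ ≡ ∑[ t < reach x ] ⟦ (marked x ∧ b) ∧ marked (x + suc t) ⟧
        linked∧-as-sum x b with marked x in mx | b
        ... | false | _ = sym (∑-zero (reach x))
        ... | true | false = ≡.trans (cong ⟦_⟧ (∧-zeroʳ _)) (sym (∑-zero (reach x)))
        ... | true | true = ≡.trans (cong ⟦_⟧ (∧-identityʳ _)) (sym (∑-indicator-atMostOne (reach x) (λ t → marked (x + suc t)) unique))
          where
          unique : AtMostOne< (reach x) (λ t → marked (x + suc t))
          unique {t} {t′} t< t′< mt mt′ with <-cmp t t′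
          ... | tri< t<t′ _ _ = ⊥-elim (true≢false (≡.trans (sym mt)
                  (pair-edge-has-no-pair-inside F proper x (suc t′) mx (s≤s z≤n) t′< mt′ (suc t) (s≤s z≤n) (s≤s t<t′))))
          ... | tri≈ _ t≡t′ _ = t≡t′
          ... | tri> _ _ t′<t = ⊥-elim (true≢false (≡.trans (sym mt′)
                  (pair-edge-has-no-pair-inside F proper x (suc t) mx (s≤s z≤n) t< mt (suc t′) (s≤s z≤n) (s≤s t′<t))))

        -- An edge between colours c and c + 1 ascends iff its source has colour c, and the sources
        -- of such edges are the linked vertices.
        lowerSources lowerSources′ : ℕ → ℕ
        lowerSources x = ⟦ linked x ∧ not (isUpper (colourAt F x)) ⟧
        lowerSources′ x = ⟦ linked x ∧ not (isUpper (newColour F x)) ⟧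

        ascents-recolour-vertex : ∀ x → ascentsFrom (recolour F) x + lowerSources x ≡ ascentsFrom F x + lowerSources′ x
        ascents-recolour-vertex x = begin
          ascentsFrom (recolour F) x + lowerSources x
            ≡⟨ cong₂ _+_ (∑-cong (reach x) (λ t _ → cong₂ (λ u v → ⟦ does (u <? v) ⟧) (colourAt-recolour x) (colourAt-recolour (x + suc t))))
                         (linked∧-as-sum x (not (isUpper u))) ⟩
          ∑[ t < reach x ] ⟦ does (newColour F x <? newColour F (x + suc t)) ⟧ + ∑[ t < reach x ] ⟦ (isPair u ∧ not (isUpper u)) ∧ marked (x + suc t) ⟧
            ≡⟨ ∑-distrib-+ (reach x) _ _ ⟨
          ∑[ t < reach x ] (⟦ does (newColour F x <? newColour F (x + suc t)) ⟧ + ⟦ (isPair u ∧ not (isUpper u)) ∧ marked (x + suc t) ⟧)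
            ≡⟨ ∑-cong (reach x) (λ t t< → ascent-swapIf (flip x) (flip (x + suc t)) (proper-edge F proper x (suc t) (s≤s z≤n) t<)
                                                        (flip-edge x (suc t) (s≤s z≤n) t<)) ⟩
          ∑[ t < reach x ] (⟦ does (u <? colourAt F (x + suc t)) ⟧ + ⟦ (isPair u ∧ not (isUpper (newColour F x))) ∧ marked (x + suc t) ⟧)
            ≡⟨ ∑-distrib-+ (reach x) _ _ ⟩
          ascentsFrom F x + ∑[ t < reach x ] ⟦ (isPair u ∧ not (isUpper (newColour F x))) ∧ marked (x + suc t) ⟧
            ≡⟨ cong (ascentsFrom F x +_) (linked∧-as-sum x (not (isUpper (newColour F x)))) ⟨
          ascentsFrom F x + lowerSources′ x ∎
          where
          open ≡-Reasoning
          u = colourAt F x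

        lowerSources-balance : ∑< n lowerSources′ ≡ ∑< n lowerSources
        lowerSources-balance = begin
          ∑< n lowerSources′
            ≡⟨ ∑-rotate~ lowerSources′ (λ x y x~y → cong₂ (λ l v → ⟦ l ∧ not (isUpper v) ⟧) (linked-cong x y x~y) (newColour-cong x y x~y)) start ⟩
          ∑[ j < n ] lowerSources′ (start + j)
            ≡⟨ ∑-cong n (λ j j<n → ≡.trans (cong (λ v → ⟦ L j ∧ not (isUpper v) ⟧) (newColour-start j j<n)) (new-bit j)) ⟩
          ∑[ j < n ] ⟦ M j ∧ L j ∧ not (colour j xor flipAt j) ⟧
            ≡⟨ linked-flip-balance ⟩
          ∑[ j < n ] ⟦ M j ∧ L j ∧ not (colour j) ⟧
            ≡⟨ ∑-cong n (λ j _ → cong ⟦_⟧ (linked-absorbs (M j) (any< (reach (start + j)) (λ t → marked (start + j + suc t))) (not (colour j)))) ⟩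
          ∑[ j < n ] lowerSources (start + j)
            ≡⟨ ∑-rotate~ lowerSources (λ x y x~y → cong₂ (λ l v → ⟦ l ∧ not (isUpper v) ⟧) (linked-cong x y x~y) (colourAt-cong x y x~y)) start ⟨
          ∑< n lowerSources ∎
          where
          open ≡-Reasoning
          M L : ℕ → Bool
          M j = marked (start + j)
          L j = linked (start + j)
          linked-absorbs : ∀ p q r → p ∧ (p ∧ q) ∧ r ≡ (p ∧ q) ∧ r
          linked-absorbs false q r = refl
          linked-absorbs true q r = refl
          new-bit : ∀ j → ⟦ L j ∧ not (isUpper (swapIf (flipAt j) (colourAt F (start + j)))) ⟧ ≡ ⟦ M j ∧ L j ∧ not (colour j xor flipAt j) ⟧
          new-bit j with M j in mj
          ... | false = refl
          ... | true = cong (λ b → ⟦ any< (reach (start + j)) (λ t → marked (start + j + suc t)) ∧ not b ⟧) (isUpper-swapIf (flipAt j) mj)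

        recolour-asc : asc a (recolour F) ≡ asc a F
        recolour-asc = +-cancelʳ-≡ (∑< n lowerSources) _ _ (begin
          asc a (recolour F) + ∑< n lowerSources
            ≡⟨ cong (_+ ∑< n lowerSources) (asc≡∑ascentsFrom (recolour F)) ⟩
          ∑< n (ascentsFrom (recolour F)) + ∑< n lowerSources
            ≡⟨ ∑-distrib-+ n (ascentsFrom (recolour F)) lowerSources ⟨
          ∑[ x < n ] (ascentsFrom (recolour F) x + lowerSources x)
            ≡⟨ ∑-cong n (λ x _ → ascents-recolour-vertex x) ⟩
          ∑[ x < n ] (ascentsFrom F x + lowerSources′ x)
            ≡⟨ ∑-distrib-+ n (ascentsFrom F) lowerSources′ ⟩
          ∑< n (ascentsFrom F) + ∑< n lowerSources′
            ≡⟨ cong₂ _+_ (asc≡∑ascentsFrom F) (sym lowerSources-balance) ⟨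
          asc a F + ∑< n lowerSources ∎)
          where open ≡-Reasoning

-- Symmetry of the coefficients

lookup≤sum : ∀ {n} (v : Vec ℕ n) i → lookup v i ≤ Vec.sum v
lookup≤sum (x ∷ᵛ v) Fin.zero = m≤m+n x _
lookup≤sum (x ∷ᵛ v) (Fin.suc i) = ≤-trans (lookup≤sum v i) (m≤n+m _ x)

content-zero-above-sum : ∀ {m} (F : Coloring m) {α} → HasContent F α → ZeroFrom (suc (Vec.sum F)) α
content-zero-above-sum {m} F content i 1+sum≤i = ≡.trans (sym (content i))
  (cong length (filter-none (λ j → lookup F j ≟ i) (universal (λ j e → <⇒≢ (≤-trans (s≤s (lookup≤sum F j)) 1+sum≤i) e) (allFin (suc m)))))

module Coefficients (m : ℕ) (a : Fin (suc m) → ℕ) (cas : CircularAreaSeq a) (k : ℕ) where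

  Counted : (ℕ → ℕ) → Coloring m → Set
  Counted α F = Proper a F × HasContent F α × asc a F ≡ k

  Counted-cong : ∀ {α β} → α ≗ β → ∀ {F} → Counted α F → Counted β F
  Counted-cong α≗β (p , h , s) = p , (λ c → ≡.trans (h c) (α≗β c)) , s

  open ContentInjections Counted Counted-cong
  open CircularGraph m a cas

  recolour-counted : ∀ c α F → Counted α F → Counted (α ∘ adjSwap c) (PairRuns.recolour c F)
  recolour-counted c α F (proper , content , ascents) =
    R.recolour-proper proper , R.recolour-content proper α content , ≡.trans (R.recolour-asc proper) ascents
    where module R = PairRuns.Recolouring c F

  ≼-adjSwap : ∀ c α → α ≼ (α ∘ adjSwap c)
  ≼-adjSwap c α = recolour , (λ {F} → recolour-counted c α F) ,
                  λ {F} {G} _ _ e → ≡.trans (sym (recolour-involutive F)) (≡.trans (cong recolour e) (recolour-involutive G))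
    where
    open PairRuns c using (recolour)
    open PairRuns.Recolouring c using (recolour-involutive)

  ≼-bijection : ∀ α (t u : ℕ → ℕ) → (∀ x → t (u x) ≡ x) → (∀ x → u (t x) ≡ x) → ∀ F → Counted α F → α ≼ (α ∘ t)
  ≼-bijection α t u t∘u u∘t F (_ , content , _) =
    ≼-permute ≼-adjSwap α t u t∘u u∘t (B + B′) (λ i p → α-zero i (≤-trans (m≤m+n B B′) p)) (λ i p → α∘t-zero i (≤-trans (m≤n+m B′ B) p))
    where
    B = suc (Vec.sum F)
    α-zero : ZeroFrom B α
    α-zero = content-zero-above-sum F content
    -- If t i < B then i = u (t i) is a term of this sum.
    B′ = suc (∑< B u)
    α∘t-zero : ZeroFrom B′ (α ∘ t)
    α∘t-zero i B′≤i with B ≤? t i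
    ... | yes B≤ti = α-zero (t i) B≤ti
    ... | no B≰ti = ⊥-elim (<⇒≱ B′≤i (≡.subst (_≤ ∑< B u) (u∘t i) (term≤∑ B u (≰⇒> B≰ti))))

  length≤ : ∀ α (t u : ℕ → ℕ) → (∀ x → t (u x) ≡ x) → (∀ x → u (t x) ≡ x) → (L L′ : List (Coloring m)) →
            EnumeratesCoeff a α k L → EnumeratesCoeff a (α ∘ t) k L′ → length L ≤ length L′
  length≤ α t u t∘u u∘t [] L′ _ _ = z≤n
  length≤ α t u t∘u u∘t (F ∷ L) L′ (unique , members) (_ , members′) =
    length≤-by-injection f (Counted α) (Counted (α ∘ t)) (F ∷ L) L′ unique
      (λ {x} → Equivalence.to (members x)) (λ {y} → Equivalence.from (members′ y)) (λ x → maps {x}) injective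
    where
    α≼α∘t : α ≼ (α ∘ t)
    α≼α∘t = ≼-bijection α t u t∘u u∘t F (Equivalence.to (members F) (here refl))
    f = proj₁ α≼α∘t
    maps = proj₁ (proj₂ α≼α∘t)
    injective = proj₂ (proj₂ α≼α∘t)

  enumerates-cong : ∀ {α β} → α ≗ β → ∀ {L} → EnumeratesCoeff a α k L → EnumeratesCoeff a β k L
  enumerates-cong α≗β (unique , members) = unique , λ F →
    mk⇔ (λ F∈ → Counted-cong α≗β {F} (Equivalence.to (members F) F∈))
        (λ counted → Equivalence.from (members F) (Counted-cong (sym ∘ α≗β) {F} counted))

mainTheorem2 : (m : ℕ) (a : Fin (suc m) → ℕ) → CircularAreaSeq a →
    (σ : ℕ ↔ ℕ) (α : ℕ → ℕ) (k : ℕ) (L L′ : List (Coloring m)) →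
    EnumeratesCoeff a α k L → EnumeratesCoeff a (α ∘ Inverse.to σ) k L′ →
    length L ≡ length L′
mainTheorem2 m a cas σ α k L L′ enumL enumL′ = ≤-antisym
  (length≤ α to from to∘from from∘to L L′ enumL enumL′)
  (length≤ (α ∘ to) from to from∘to to∘from L′ L enumL′ (enumerates-cong (λ c → cong α (sym (to∘from c))) enumL))
  where
  open Coefficients m a cas k
  open Inverse σ using (to; from) renaming (strictlyInverseˡ to to∘from; strictlyInverseʳ to from∘to)
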